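{- Consider Algorithm VA with an integer parameter $k$ with $3\le k\le n$, in the secretary matching problem with vertex arrival (setting in the context). For every $t$ with $k\le t\le n$, every set $\widetilde V\subseteq V$ with $|\widetilde V|=t$, and every vertex $u\in\widetilde V$, $$\Pr\left[\,u \text{ is matched by time } t \;\middle|\; V_t=\widetilde V\,\right] \;=\; \frac{2}{3}\left(1-\frac{(t-3)!\,k!}{t!\,(k-3)!}\right),$$ where "$u$ is matched by time $t$" means that $u$ has been matched (i.e., removed from $A$) in some round $\le t$, and the probability is over the random arrival order and the algorithm's internal randomness.
   Context: Setting (secretary matching with vertex arrival): $G=(V,E)$ is a complete graph on $n$ vertices with edge weights $w_e\ge 0$; for $T\subseteq V$, $G(T)$ is the induced subgraph; for a matching $\mu$, $\mu(v)$ is the partner of $v$. Standing assumption: for every $T\subseteq V$ of even size the maximum weight matching of $G(T)$ is unique and perfect. The vertices arrive in a uniformly random order $v_1,\dots,v_n$; $V_t=\{v_1,\dots,v_t\}$. When $v_t$ arrives, the weights of its edges to $v_1,\dots,v_{t-1}$ are revealed. Algorithm VA (parameter $k$): set $A=V$ and $\mu=\emptyset$. For $t=k+1,\dots,n$: if $t$ is odd, choose $r_t\in\{1,\dots,t-1\}$ uniformly at random and set $V'_t=V_t\setminus\{v_{r_t}\}$; if $t$ is even set $V'_t=V_t$. Let $\mu_t$ be the maximum weight (perfect) matching of $G(V'_t)$. If $\mu_t(v_t)\in V_t\cap A$, add the edge $v_t\mu_t(v_t)$ to $\mu$ and remove $v_t$ and $\mu_t(v_t)$ from $A$. Return $\m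u$.
   Formalization: The edge weights are nonnegative rationals rather than nonnegative reals. -}

module Defs where

open import Data.Nat using (ℕ; zero; suc; _∸_; _<ᵇ_; _≡ᵇ_; _%_; _!; _*_)
open import Data.Bool using (Bool; true; false; if_then_else_; _∧_; not)
open import Data.Fin using (Fin)
open import Data.Fin.Subset using (Subset; ⁅_⁆; _∪_; _∈_; _∉_; _-_; ∣_∣; ⊥; ⊤)
open import Data.Fin.Subset.Properties using (_∈?_)
open import Data.Vec using (lookup)
open import Data.Vec.Properties using (≡-dec)
open import Data.List using (List; []; _∷_; map; concatMap; foldr; foldl; take; length; filter; upTo; allFin; cartesianProduct)
open import Data.Maybe using (Maybe; just; nothing; maybe)
open import Data.Product using (_×_; _,_; proj₁; proj₂)
open import Data.Integer using (+_)
open import Data.Rational using (ℚ; 0ℚ; 1ℚ; _+_; _≤_) renaming (_*_ to _*ℚ_; _/_ to _/ℚ_; _-_ to _-ℚ_)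
open import Relation.Nullary using (¬_; does)
open import Relation.Binary.PropositionalEquality using (_≡_; _≢_)
import Data.Bool as B

-- A weighted complete graph on vertex set Fin n: symmetric, nonnegative
-- weights (loops w v v are never used).
record WeightedGraph (n : ℕ) : Set where
  field
    w    : Fin n → Fin n → ℚ
    sym  : ∀ i j → w i j ≡ w j i
    nonneg : ∀ i j → 0ℚ ≤ w i j

-- A (not necessarily perfect) matching of G(T), given by the partner
-- function: m v ≡ just u  means  v u  is an edge of the matching.
IsMatching : ∀ {n} → Subset n → (Fin n → Maybe (Fin n)) → Set
IsMatching T m = ∀ v u → m v ≡ just u → (v ∈ T) × (u ∈ T) × (u ≢ v) × (m u ≡ just v)

sumℚ : List ℚ → ℚ
sumℚ = foldr _+_ 0ℚ

-- Twice the weight of a matching (every edge is counted from both ends).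
weight2 : ∀ {n} → WeightedGraph n → (Fin n → Maybe (Fin n)) → ℚ
weight2 {n} G m = sumℚ (map (λ v → maybe (WeightedGraph.w G v) 0ℚ (m v)) (allFin n))

IsPerfectMatching : ∀ {n} → Subset n → (Fin n → Fin n) → Set
IsPerfectMatching T f = ∀ v → v ∈ T → (f v ∈ T) × (f v ≢ v) × (f (f v) ≡ v)

restrict : ∀ {n} → Subset n → (Fin n → Fin n) → Fin n → Maybe (Fin n)
restrict T f v = if lookup T v then just (f v) else nothing

IsUniqueMaxPerfect : ∀ {n} → WeightedGraph n → Subset n → (Fin n → Fin n) → Set
IsUniqueMaxPerfect G T f =
  IsPerfectMatching T f ×
  (∀ m → IsMatching T m →
     (weight2 G m ≤ weight2 G (restrict T f)) ×
     (weight2 G m ≡ weight2 G (restrict T f) → ∀ v → m v ≡ restrict T f v))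

MaxMatchingOracle : ∀ {n} → WeightedGraph n → (Subset n → Fin n → Fin n) → Set
MaxMatchingOracle {n} G mm = ∀ (T : Subset n) → ∣ T ∣ % 2 ≡ 0 → IsUniqueMaxPerfect G T (mm T)

insertions : {A : Set} → A → List A → List (List A)
insertions x []       = (x ∷ []) ∷ []
insertions x (y ∷ ys) = (x ∷ y ∷ ys) ∷ map (y ∷_) (insertions x ys)

perms : {A : Set} → List A → List (List A)
perms []       = [] ∷ []
perms (x ∷ xs) = concatMap (insertions x) (perms xs)

-- all arrival orders v_1, …, v_n (uniform distribution = uniform over this list)
arrivalOrders : (n : ℕ) → List (List (Fin n))
arrivalOrders n = perms (allFin n)

odd : ℕ → Bool
odd t = (t % 2) ≡ᵇ 1

-- possible values of the internal random choice in round t: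
-- for t odd with k < t, r_t - 1 ∈ {0, …, t-2}; otherwise a dummy 0.
choices : ℕ → ℕ → List ℕ
choices k t = if odd t ∧ (k <ᵇ t) then upTo (t ∸ 1) else (0 ∷ [])

-- all random tapes [r'_1, …, r'_m] for rounds 1..m (r'_t = r_t - 1);
-- uniform over this list = independent uniform r_t.
tapesFrom : ℕ → ℕ → ℕ → List (List ℕ)
tapesFrom k t zero    = [] ∷ []
tapesFrom k t (suc m) = concatMap (λ r → map (r ∷_) (tapesFrom k (suc t) m)) (choices k t)

allTapes : ℕ → ℕ → List (List ℕ)
allTapes n k = tapesFrom k 1 n

nth : {A : Set} → List A → ℕ → Maybe A
nth []       _       = nothing
nth (x ∷ xs) zero    = just x
nth (x ∷ xs) (suc i) = nth xs i

removeAt : {A : Set} → ℕ → List A → List A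
removeAt _       []       = []
removeAt zero    (x ∷ xs) = xs
removeAt (suc i) (x ∷ xs) = x ∷ removeAt i xs

setOf : ∀ {n} → List (Fin n) → Subset n
setOf = foldr (λ v s → ⁅ v ⁆ ∪ s) ⊥

-- One round t of Algorithm VA acting on the set A of available vertices.
-- order = [v_1,…,v_n], tape = random tape, mm = maximum matching oracle.
stepVA : ∀ {n} → (Subset n → Fin n → Fin n) → List (Fin n) → List ℕ → ℕ → Subset n → Subset n
stepVA mm order tape t A with nth order (t ∸ 1)
... | nothing = A
... | just vt =
  let Vt  = take t order
      r   = maybe (λ x → x) 0 (nth tape (t ∸ 1))
      V't = if odd t then removeAt r Vt else Vt
      p   = mm (setOf V't) vt
  in if lookup (setOf Vt) p ∧ lookup A p then (A - vt) - p else A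

roundsVA : ℕ → ℕ → List ℕ
roundsVA k t = map (λ i → suc (k Data.Nat.+ i)) (upTo (t ∸ k))

availableAfter : ∀ {n} → (Subset n → Fin n → Fin n) → ℕ → List (Fin n) → List ℕ → ℕ → Subset n
availableAfter mm k order tape t = foldl (λ A s → stepVA mm order tape s A) ⊤ (roundsVA k t)

matchedBy : ∀ {n} → (Subset n → Fin n → Fin n) → ℕ → List (Fin n) → List ℕ → ℕ → Fin n → Bool
matchedBy mm k order tape t u = not (lookup (availableAfter mm k order tape t) u)

count : {A : Set} → (A → Bool) → List A → ℕ
count P xs = length (filter (λ x → B.T? (P x)) xs)

ratio : ℕ → ℕ → ℚ
ratio a zero    = 0ℚ
ratio a (suc b) = (+ a) /ℚ (suc b)

sameSet : ∀ {n} → Subset n → Subset n → Bool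
sameSet S S' = does (≡-dec B._≟_ S S')

probMatchedGiven : ∀ {n} → (Subset n → Fin n → Fin n) → ℕ → ℕ → Subset n → Fin n → ℚ
probMatchedGiven {n} mm k t V u =
  let Ω    = cartesianProduct (arrivalOrders n) (allTapes n k)
      cond = λ (ω : List (Fin n) × List ℕ) → sameSet (setOf (take t (proj₁ ω))) V
      ev   = λ (ω : List (Fin n) × List ℕ) → cond ω ∧ matchedBy mm k (proj₁ ω) (proj₂ ω) t u
  in ratio (count ev Ω) (count cond Ω)

targetProb : ℕ → ℕ → ℚ
targetProb k t = ratio 2 3 *ℚ (1ℚ -ℚ ratio ((t ∸ 3) ! * k !) (t ! * (k ∸ 3) !))

-- Conditioned on V_t = V, the first t arrivals form a uniformly random arrangement of V and the
-- later arrivals are irrelevant, so the probability is N / (K + N), where K and N count the pairs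
-- (arrangement of V, random tape) after which u is still available, resp. matched, at time t.
-- These counts depend only on t. Split on the last arrival y. If y = u, then u survives round
-- t + 1 exactly when its partner was already matched (N pairs). If y ≠ u, then u survives when it
-- was available and is not the partner of y; as the oracle matching of the even set V (t + 1 even),
-- resp. of V - x for the discarded vertex x (t + 1 odd), is perfect, u is the partner of exactly
-- one such y (for each x ≠ u). This gives K' = N + (t - 1) K and N' = 2 K + t N, so p = N / (K + N)
-- satisfies p' = (2 + (t - 2) p) / (t + 1) with p = 0 at t = k, which is solved by
-- 2/3 (1 - C(k,3) / C(t,3)).

module Submission where

open import Defs
open import Data.Nat using (ℕ; _≤_)
open import Data.Fin using (Fin)
open import Data.Fin.Subset using (Subset; _∈_; ∣_∣)
open import Data.Rational using (ℚ)
open import Relation.Binary.PropositionalEquality using (_≡_)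

open import Data.Nat hiding (_≟_; _≤_; _≡ᵇ_; ∣_-_∣)
open import Data.Nat.Properties hiding (_≟_; ≡ᵇ⇒≡)
open import Data.Nat.Tactic.RingSolver using (solve-∀)
open import Data.Bool using (Bool; true; false; if_then_else_; _∧_; _∨_; not; T; _≟_)
open import Data.Bool.Properties
  using (∧-identityʳ; ∧-zeroʳ; ∧-comm; ∨-identityʳ; ∨-zeroʳ; ∨-assoc; ∨-comm)
open import Data.Fin using (zero; suc)
open import Data.Fin.Properties using () renaming (_≟_ to _≟ᶠ_)
open import Data.Fin.Subset using (⁅_⁆; _─_; _-_; ⊥; ⊤)
open import Data.Vec using (lookup; _∷_; []; zipWith)
open import Data.Vec.Properties
  using (≡-dec; lookup-zipWith; lookup-replicate; tabulate∘lookup; tabulate-cong; []=⇒lookup; lookup⇒[]=)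
open import Data.List
  using (List; []; _∷_; [_]; _++_; map; concatMap; foldl; length; take; tabulate; allFin; applyUpTo; upTo; cartesianProduct)
import Data.List.Properties as List
open import Data.Maybe using (Maybe; just; nothing; maybe)
open import Data.Product using (Σ-syntax; _×_; _,_; proj₁; proj₂)
open import Data.Sum using (_⊎_; inj₁; inj₂)
open import Data.Unit using (tt) renaming (⊤ to Unit)
open import Data.Empty using (⊥-elim)
open import Function using (case_of_)
open import Relation.Nullary using (yes; no)
import Data.Integer as ℤ
open import Data.Integer.Properties using (pos-+; pos-*)
import Data.Integer.Tactic.RingSolver as ℤ-Solver
open import Data.Rational using (1ℚ; toℚᵘ) renaming (_*_ to _*ℚ_; _-_ to _-ℚ_; -_ to -ℚ_)
open import Data.Rational.Properties using (toℚᵘ-injective; toℚᵘ-fromℚᵘ; toℚᵘ-homo-*; toℚᵘ-homo-+; toℚᵘ-homo‿-)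
open import Data.Rational.Unnormalised using (mkℚᵘ; _≃_; *≡*)
import Data.Rational.Unnormalised as ℚᵘ
import Data.Rational.Unnormalised.Properties as ℚᵘ
open import Relation.Binary.PropositionalEquality
  using (_≢_; refl; sym; trans; cong; cong₂; subst; module ≡-Reasoning)

open ≡-Reasoning

-- Finite sums and indicators

∑ : {A : Set} → List A → (A → ℕ) → ℕ
∑ []       f = 0
∑ (x ∷ xs) f = f x + ∑ xs f

⟦_⟧ : Bool → ℕ
⟦ true ⟧  = 1
⟦ false ⟧ = 0

module _ {A : Set} where

  ∑-++ : (xs ys : List A) (f : A → ℕ) → ∑ (xs ++ ys) f ≡ ∑ xs f + ∑ ys f
  ∑-++ []       ys f = refl
  ∑-++ (x ∷ xs) ys f = trans (cong (f x +_) (∑-++ xs ys f)) (sym (+-assoc (f x) _ _))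

  ∑-cong : (xs : List A) {f g : A → ℕ} → (∀ x → f x ≡ g x) → ∑ xs f ≡ ∑ xs g
  ∑-cong []       e = refl
  ∑-cong (x ∷ xs) e = cong₂ _+_ (e x) (∑-cong xs e)

  ∑-+ : (xs : List A) (f g : A → ℕ) → ∑ xs (λ x → f x + g x) ≡ ∑ xs f + ∑ xs g
  ∑-+ []       f g = refl
  ∑-+ (x ∷ xs) f g rewrite ∑-+ xs f g = +-exch (f x) (g x) (∑ xs f) (∑ xs g)
    where
    +-exch : ∀ a b c d → a + b + (c + d) ≡ a + c + (b + d)
    +-exch = solve-∀

  ∑-*ˡ : (c : ℕ) (xs : List A) (f : A → ℕ) → ∑ xs (λ x → c * f x) ≡ c * ∑ xs f
  ∑-*ˡ c []       f = sym (*-zeroʳ c)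
  ∑-*ˡ c (x ∷ xs) f = trans (cong (c * f x +_) (∑-*ˡ c xs f)) (sym (*-distribˡ-+ c (f x) (∑ xs f)))

  ∑-*ʳ : (c : ℕ) (xs : List A) (f : A → ℕ) → ∑ xs (λ x → f x * c) ≡ ∑ xs f * c
  ∑-*ʳ c xs f = trans (∑-cong xs (λ x → *-comm (f x) c)) (trans (∑-*ˡ c xs f) (*-comm c _))

  ∑-zero : (xs : List A) → ∑ xs (λ _ → 0) ≡ 0
  ∑-zero []       = refl
  ∑-zero (x ∷ xs) = ∑-zero xs

  ∑-const : (xs : List A) (c : ℕ) → ∑ xs (λ _ → c) ≡ length xs * c
  ∑-const []       c = refl
  ∑-const (x ∷ xs) c = cong (c +_) (∑-const xs c)

module _ {A B : Set} where

  ∑-map : (g : A → B) (xs : List A) (f : B → ℕ) → ∑ (map g xs) f ≡ ∑ xs (λ x → f (g x))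
  ∑-map g []       f = refl
  ∑-map g (x ∷ xs) f = cong (f (g x) +_) (∑-map g xs f)

  ∑-concatMap : (g : A → List B) (xs : List A) (f : B → ℕ) →
                ∑ (concatMap g xs) f ≡ ∑ xs (λ x → ∑ (g x) f)
  ∑-concatMap g []       f = refl
  ∑-concatMap g (x ∷ xs) f =
    trans (∑-++ (g x) (concatMap g xs) f) (cong (∑ (g x) f +_) (∑-concatMap g xs f))

  ∑-swap : (xs : List A) (ys : List B) (f : A → B → ℕ) →
           ∑ xs (λ x → ∑ ys (f x)) ≡ ∑ ys (λ y → ∑ xs (λ x → f x y))
  ∑-swap []       ys f = sym (∑-zero ys)
  ∑-swap (x ∷ xs) ys f =
    trans (cong (∑ ys (f x) +_) (∑-swap xs ys f)) (sym (∑-+ ys (f x) (λ y → ∑ xs (λ x' → f x' y))))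

∑-cartesianProduct : {A B : Set} (xs : List A) (ys : List B) (f : A × B → ℕ) →
                     ∑ (cartesianProduct xs ys) f ≡ ∑ xs (λ x → ∑ ys (λ y → f (x , y)))
∑-cartesianProduct []       ys f = refl
∑-cartesianProduct (x ∷ xs) ys f =
  trans (∑-++ (map (x ,_) ys) _ f) (cong₂ _+_ (∑-map (x ,_) ys f) (∑-cartesianProduct xs ys f))

∑-swap-weighted : {A B C : Set} (as : List A) (bs : List B) (cs : List C) (s : A → ℕ) (w : C → ℕ) (F : A → B → C → ℕ) →
  ∑ as (λ a → s a * ∑ bs (λ b → ∑ cs (λ c → w c * F a b c)))
    ≡ ∑ cs (λ c → w c * ∑ as (λ a → s a * ∑ bs (λ b → F a b c)))
∑-swap-weighted as bs cs s w F = begin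
  ∑ as (λ a → s a * ∑ bs (λ b → ∑ cs (λ c → w c * F a b c)))
    ≡⟨ ∑-cong as (λ a → trans (sym (∑-*ˡ (s a) bs _)) (∑-cong bs (λ b → sym (∑-*ˡ (s a) cs _)))) ⟩
  ∑ as (λ a → ∑ bs (λ b → ∑ cs (λ c → s a * (w c * F a b c))))
    ≡⟨ ∑-cong as (λ a → ∑-swap bs cs _) ⟩
  ∑ as (λ a → ∑ cs (λ c → ∑ bs (λ b → s a * (w c * F a b c))))
    ≡⟨ ∑-swap as cs _ ⟩
  ∑ cs (λ c → ∑ as (λ a → ∑ bs (λ b → s a * (w c * F a b c))))
    ≡⟨ ∑-cong cs (λ c → ∑-cong as (λ a → ∑-cong bs (λ b → exchange (s a) (w c) (F a b c)))) ⟩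
  ∑ cs (λ c → ∑ as (λ a → ∑ bs (λ b → w c * (s a * F a b c))))
    ≡⟨ ∑-cong cs (λ c → trans (∑-cong as (λ a → trans (∑-*ˡ (w c) bs _) (cong (w c *_) (∑-*ˡ (s a) bs _)))) (∑-*ˡ (w c) as _)) ⟩
  ∑ cs (λ c → w c * ∑ as (λ a → s a * ∑ bs (λ b → F a b c))) ∎
  where
  exchange : ∀ a b c → a * (b * c) ≡ b * (a * c)
  exchange = solve-∀

count≡∑ : {A : Set} (P : A → Bool) (xs : List A) → count P xs ≡ ∑ xs (λ x → ⟦ P x ⟧)
count≡∑ P []       = refl
count≡∑ P (x ∷ xs) with P x
... | true  = cong suc (count≡∑ P xs)
... | false = count≡∑ P xs

⟦∧⟧ : ∀ a b → ⟦ a ∧ b ⟧ ≡ ⟦ a ⟧ * ⟦ b ⟧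
⟦∧⟧ true  b = sym (+-identityʳ ⟦ b ⟧)
⟦∧⟧ false b = refl

⟦⟧+⟦not⟧ : ∀ a → ⟦ a ⟧ + ⟦ not a ⟧ ≡ 1
⟦⟧+⟦not⟧ true  = refl
⟦⟧+⟦not⟧ false = refl

⟦⟧*-cong : ∀ b {x y} → (b ≡ true → x ≡ y) → ⟦ b ⟧ * x ≡ ⟦ b ⟧ * y
⟦⟧*-cong true  f = cong (_+ 0) (f refl)
⟦⟧*-cong false f = refl

∨≡false : ∀ a b → a ∨ b ≡ false → (a ≡ false) × (b ≡ false)
∨≡false false false _ = refl , refl

∨≡true : ∀ a b → a ∨ b ≡ true → (a ≡ true) ⊎ (b ≡ true)
∨≡true true  b _ = inj₁ refl
∨≡true false b e = inj₂ e

∧≡true : ∀ a b → a ∧ b ≡ true → (a ≡ true) × (b ≡ true)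
∧≡true true true _ = refl , refl

not≡true : ∀ a → not a ≡ true → a ≡ false
not≡true false _ = refl

true⇔true⇒≡ : ∀ a b → (a ≡ true → b ≡ true) → (b ≡ true → a ≡ true) → a ≡ b
true⇔true⇒≡ true  b     f g = sym (f refl)
true⇔true⇒≡ false true  f g = g refl
true⇔true⇒≡ false false f g = refl

-- Subsets of Fin n

-- Defined by the recursion of ⁅_⁆, so that lookup ⁅ x ⁆ z reduces to it (lookup-⁅⁆).
infix 7 _≡ᵇ_

_≡ᵇ_ : ∀ {n} → Fin n → Fin n → Bool
zero  ≡ᵇ zero  = true
zero  ≡ᵇ suc _ = false
suc _ ≡ᵇ zero  = false
suc x ≡ᵇ suc y = x ≡ᵇ y

≡ᵇ-refl : ∀ {n} (x : Fin n) → (x ≡ᵇ x) ≡ true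
≡ᵇ-refl zero    = refl
≡ᵇ-refl (suc x) = ≡ᵇ-refl x

≡ᵇ-sym : ∀ {n} (x y : Fin n) → (x ≡ᵇ y) ≡ (y ≡ᵇ x)
≡ᵇ-sym zero    zero    = refl
≡ᵇ-sym zero    (suc y) = refl
≡ᵇ-sym (suc x) zero    = refl
≡ᵇ-sym (suc x) (suc y) = ≡ᵇ-sym x y

≡ᵇ⇒≡ : ∀ {n} {x y : Fin n} → (x ≡ᵇ y) ≡ true → x ≡ y
≡ᵇ⇒≡ {x = zero}  {zero}  _ = refl
≡ᵇ⇒≡ {x = suc x} {suc y} e = cong suc (≡ᵇ⇒≡ e)

≢⇒≡ᵇ-false : ∀ {n} {x y : Fin n} → x ≢ y → (x ≡ᵇ y) ≡ false
≢⇒≡ᵇ-false {x = x} {y} x≢y with x ≡ᵇ y in e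
... | true  = ⊥-elim (x≢y (≡ᵇ⇒≡ e))
... | false = refl

lookup-⁅⁆ : ∀ {n} (x z : Fin n) → lookup ⁅ x ⁆ z ≡ (x ≡ᵇ z)
lookup-⁅⁆ zero    zero    = refl
lookup-⁅⁆ zero    (suc z) = lookup-replicate z false
lookup-⁅⁆ (suc x) zero    = refl
lookup-⁅⁆ (suc x) (suc z) = lookup-⁅⁆ x z

lookup-─ : ∀ {n} (p q : Subset n) (z : Fin n) → lookup (p ─ q) z ≡ lookup p z ∧ not (lookup q z)
lookup-─ (a ∷ p) (b ∷ q) zero    with a | b
... | true  | true  = refl
... | true  | false = refl
... | false | true  = refl
... | false | false = refl
lookup-─ (a ∷ p) (b ∷ q) (suc z) = lookup-─ p q z

module _ {n : ℕ} where

  lookup-minus : (p : Subset n) (y z : Fin n) → lookup (p - y) z ≡ lookup p z ∧ not (y ≡ᵇ z)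
  lookup-minus p y z = trans (lookup-─ p ⁅ y ⁆ z) (cong (λ b → lookup p z ∧ not b) (lookup-⁅⁆ y z))

  Subset-ext : (p q : Subset n) → (∀ z → lookup p z ≡ lookup q z) → p ≡ q
  Subset-ext p q e = trans (sym (tabulate∘lookup p)) (trans (tabulate-cong e) (tabulate∘lookup q))

  sameSet-refl : (p : Subset n) → sameSet p p ≡ true
  sameSet-refl p with ≡-dec _≟_ p p
  ... | yes _  = refl
  ... | no p≢p = ⊥-elim (p≢p refl)

  sameSet⇒≡ : (p q : Subset n) → sameSet p q ≡ true → p ≡ q
  sameSet⇒≡ p q e with ≡-dec _≟_ p q
  ... | yes p≡q = p≡q

  infix 7 _∈ᵇ_

  _∈ᵇ_ : Fin n → List (Fin n) → Bool
  z ∈ᵇ xs = lookup (setOf xs) z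

  ∈ᵇ-[] : (z : Fin n) → (z ∈ᵇ []) ≡ false
  ∈ᵇ-[] z = lookup-replicate z false

  ∈ᵇ-∷ : (z x : Fin n) (xs : List (Fin n)) → (z ∈ᵇ (x ∷ xs)) ≡ (x ≡ᵇ z) ∨ (z ∈ᵇ xs)
  ∈ᵇ-∷ z x xs = trans (lookup-zipWith _∨_ z ⁅ x ⁆ (setOf xs)) (cong (_∨ (z ∈ᵇ xs)) (lookup-⁅⁆ x z))

  ∈ᵇ-∷ʳ : (z : Fin n) (xs : List (Fin n)) (y : Fin n) → (z ∈ᵇ (xs ++ [ y ])) ≡ (z ∈ᵇ xs) ∨ (y ≡ᵇ z)
  ∈ᵇ-∷ʳ z []       y rewrite ∈ᵇ-∷ z y [] | ∈ᵇ-[] z = ∨-identityʳ (y ≡ᵇ z)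
  ∈ᵇ-∷ʳ z (x ∷ xs) y rewrite ∈ᵇ-∷ z x (xs ++ [ y ]) | ∈ᵇ-∷ z x xs | ∈ᵇ-∷ʳ z xs y =
    sym (∨-assoc (x ≡ᵇ z) (z ∈ᵇ xs) (y ≡ᵇ z))

  Distinct : List (Fin n) → Set
  Distinct []       = Unit
  Distinct (x ∷ xs) = ((x ∈ᵇ xs) ≡ false) × Distinct xs

∑-tabulate : ∀ {m n} (g : Fin m → Fin n) (f : Fin n → ℕ) →
             ∑ (tabulate g) f ≡ ∑ (allFin m) (λ i → f (g i))
∑-tabulate {zero}  g f = refl
∑-tabulate {suc m} g f = cong (f (g zero) +_)
  (trans (∑-tabulate (λ i → g (suc i)) f) (sym (∑-tabulate suc (λ i → f (g i)))))

∑-allFin-suc : ∀ {n} (f : Fin (suc n) → ℕ) → ∑ (allFin (suc n)) f ≡ f zero + ∑ (allFin n) (λ i → f (suc i))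
∑-allFin-suc f = cong (f zero +_) (∑-tabulate suc f)

∑-δ : ∀ {n} (x : Fin n) (h : Fin n → ℕ) → ∑ (allFin n) (λ y → ⟦ x ≡ᵇ y ⟧ * h y) ≡ h x
∑-δ {suc n} zero h = begin
  ∑ (allFin (suc n)) (λ y → ⟦ zero ≡ᵇ y ⟧ * h y) ≡⟨ ∑-allFin-suc (λ y → ⟦ zero ≡ᵇ y ⟧ * h y) ⟩
  h zero + 0 + ∑ (allFin n) (λ _ → 0)           ≡⟨ cong₂ _+_ (+-identityʳ (h zero)) (∑-zero (allFin n)) ⟩
  h zero + 0                                    ≡⟨ +-identityʳ (h zero) ⟩
  h zero                                        ∎
∑-δ {suc n} (suc x) h = trans (∑-allFin-suc (λ y → ⟦ suc x ≡ᵇ y ⟧ * h y)) (∑-δ x (λ i → h (suc i)))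

∑-δ₁ : ∀ {n} (x : Fin n) → ∑ (allFin n) (λ y → ⟦ x ≡ᵇ y ⟧) ≡ 1
∑-δ₁ {n} x = trans (∑-cong (allFin n) (λ y → sym (*-identityʳ ⟦ x ≡ᵇ y ⟧))) (∑-δ x (λ _ → 1))

∣p∣≡∑ : ∀ {n} (p : Subset n) → ∣ p ∣ ≡ ∑ (allFin n) (λ z → ⟦ lookup p z ⟧)
∣p∣≡∑ []          = refl
∣p∣≡∑ (true ∷ p)  = trans (cong suc (∣p∣≡∑ p)) (sym (∑-allFin-suc (λ z → ⟦ lookup (true ∷ p) z ⟧)))
∣p∣≡∑ (false ∷ p) = trans (∣p∣≡∑ p) (sym (∑-allFin-suc (λ z → ⟦ lookup (false ∷ p) z ⟧)))

module _ {n : ℕ} where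

  ∣p-x∣≡∑ : (p : Subset n) (x : Fin n) → ∣ p - x ∣ ≡ ∑ (allFin n) (λ z → ⟦ lookup p z ∧ not (x ≡ᵇ z) ⟧)
  ∣p-x∣≡∑ p x = trans (∣p∣≡∑ (p - x)) (∑-cong (allFin n) (λ z → cong ⟦_⟧ (lookup-minus p x z)))

  suc∣p-x∣≡∣p∣ : (p : Subset n) (x : Fin n) → lookup p x ≡ true → suc ∣ p - x ∣ ≡ ∣ p ∣
  suc∣p-x∣≡∣p∣ p x x∈p = sym (begin
    ∣ p ∣                                                  ≡⟨ ∣p∣≡∑ p ⟩
    ∑ (allFin n) (λ z → ⟦ lookup p z ⟧)                    ≡⟨ ∑-cong (allFin n) split ⟩
    ∑ (allFin n) (λ z → ⟦ x ≡ᵇ z ⟧ * 1 + ⟦ lookup p z ∧ not (x ≡ᵇ z) ⟧)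
      ≡⟨ ∑-+ (allFin n) _ _ ⟩
    ∑ (allFin n) (λ z → ⟦ x ≡ᵇ z ⟧ * 1) + ∑ (allFin n) (λ z → ⟦ lookup p z ∧ not (x ≡ᵇ z) ⟧)
      ≡⟨ cong₂ _+_ (∑-δ x (λ _ → 1)) (sym (∣p-x∣≡∑ p x)) ⟩
    suc ∣ p - x ∣                                          ∎)
    where
    split : ∀ z → ⟦ lookup p z ⟧ ≡ ⟦ x ≡ᵇ z ⟧ * 1 + ⟦ lookup p z ∧ not (x ≡ᵇ z) ⟧
    split z with x ≟ᶠ z
    ... | yes refl rewrite ≡ᵇ-refl x | x∈p = refl
    ... | no x≢z rewrite ≢⇒≡ᵇ-false x≢z | ∧-identityʳ (lookup p z) = refl

∣p∣≡0⇒p≡⊥ : ∀ {n} (p : Subset n) → ∣ p ∣ ≡ 0 → p ≡ ⊥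
∣p∣≡0⇒p≡⊥ []          _ = refl
∣p∣≡0⇒p≡⊥ (false ∷ p) e = cong (false ∷_) (∣p∣≡0⇒p≡⊥ p e)

module _ {n : ℕ} where

  ∈-minus : (V : Subset n) (x z : Fin n) → lookup V z ≡ true → x ≡ᵇ z ≡ false → lookup (V - x) z ≡ true
  ∈-minus V x z z∈V x≢z rewrite lookup-minus V x z | z∈V | x≢z = refl

  ∈-minus⁻ : (V : Subset n) (x z : Fin n) → lookup (V - x) z ≡ true → (lookup V z ≡ true) × (x ≡ᵇ z ≡ false)
  ∈-minus⁻ V x z z∈V-x with ∧≡true _ _ (trans (sym (lookup-minus V x z)) z∈V-x)
  ... | z∈V , x≢z = z∈V , not≡true _ x≢z

  ∉-minus : (V : Subset n) (x : Fin n) → lookup (V - x) x ≡ false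
  ∉-minus V x rewrite lookup-minus V x x | ≡ᵇ-refl x = ∧-zeroʳ (lookup V x)

  ∣p-x∣≡pred : (V : Subset n) (x : Fin n) {t : ℕ} → ∣ V ∣ ≡ suc t → lookup V x ≡ true → ∣ V - x ∣ ≡ t
  ∣p-x∣≡pred V x ∣V∣≡1+t x∈V = suc-injective (trans (suc∣p-x∣≡∣p∣ V x x∈V) ∣V∣≡1+t)

  ∑-minus-∋ : (V : Subset n) (u : Fin n) (t : ℕ) → ∣ V ∣ ≡ suc t → lookup V u ≡ true →
              ∑ (allFin n) (λ x → ⟦ lookup V x ⟧ * ⟦ lookup (V - x) u ⟧) ≡ t
  ∑-minus-∋ V u t ∣V∣≡1+t u∈V = begin
    ∑ (allFin n) (λ x → ⟦ lookup V x ⟧ * ⟦ lookup (V - x) u ⟧)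
      ≡⟨ ∑-cong (allFin n) other ⟩
    ∑ (allFin n) (λ x → ⟦ lookup V x ∧ not (u ≡ᵇ x) ⟧)
      ≡⟨ sym (∣p-x∣≡∑ V u) ⟩
    ∣ V - u ∣
      ≡⟨ ∣p-x∣≡pred V u ∣V∣≡1+t u∈V ⟩
    t ∎
    where
    other : ∀ x → ⟦ lookup V x ⟧ * ⟦ lookup (V - x) u ⟧ ≡ ⟦ lookup V x ∧ not (u ≡ᵇ x) ⟧
    other x rewrite lookup-minus V x u | u∈V | ≡ᵇ-sym x u = sym (⟦∧⟧ (lookup V x) _)

⟦∈-minus⟧-swap : ∀ {n} (V : Subset n) (x y : Fin n) →
                 ⟦ lookup V y ⟧ * ⟦ lookup (V - y) x ⟧ ≡ ⟦ lookup V x ⟧ * ⟦ lookup (V - x) y ⟧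
⟦∈-minus⟧-swap V x y rewrite lookup-minus V y x | lookup-minus V x y | ≡ᵇ-sym x y
                            | ⟦∧⟧ (lookup V x) (not (y ≡ᵇ x)) | ⟦∧⟧ (lookup V y) (not (y ≡ᵇ x))
  = reorder ⟦ lookup V y ⟧ ⟦ lookup V x ⟧ ⟦ not (y ≡ᵇ x) ⟧
  where
  reorder : ∀ a b c → a * (b * c) ≡ b * (a * c)
  reorder = solve-∀

-- Arrangements

-- The arrangements (injective sequences) of length j, built by the same recursion as perms,
-- so that the length-j prefixes of perms l run over arrangements j l, each (length l ∸ j) ! times.
arrangements : {X : Set} → ℕ → List X → List (List X)
arrangements zero    xs       = [] ∷ []
arrangements (suc j) []       = []
arrangements (suc j) (x ∷ xs) = arrangements (suc j) xs ++ concatMap (insertions x) (arrangements j xs)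

module _ {X : Set} where

  ∑-insertions-const : (x : X) (σ : List X) (c : ℕ) → ∑ (insertions x σ) (λ _ → c) ≡ suc (length σ) * c
  ∑-insertions-const x []       c = refl
  ∑-insertions-const x (y ∷ ys) c =
    cong (c +_) (trans (∑-map (y ∷_) (insertions x ys) (λ _ → c)) (∑-insertions-const x ys c))

  ∑-insertions-length : (x : X) (σ : List X) (h : ℕ → List X → ℕ) →
                        ∑ (insertions x σ) (λ ρ → h (length ρ) ρ) ≡ ∑ (insertions x σ) (h (suc (length σ)))
  ∑-insertions-length x []       h = refl
  ∑-insertions-length x (y ∷ ys) h = cong (h (suc (suc (length ys))) (x ∷ y ∷ ys) +_)
    (trans (∑-map (y ∷_) (insertions x ys) _)
    (trans (∑-insertions-length x ys (λ m ρ → h (suc m) (y ∷ ρ))) (sym (∑-map (y ∷_) (insertions x ys) _))))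

  ∑-perms-length : (l : List X) (g : ℕ → List X → ℕ) → ∑ (perms l) (λ σ → g (length σ) σ) ≡ ∑ (perms l) (g (length l))
  ∑-perms-length []       g = refl
  ∑-perms-length (x ∷ xs) g = begin
    ∑ (concatMap (insertions x) (perms xs)) (λ σ → g (length σ) σ)
      ≡⟨ ∑-concatMap (insertions x) (perms xs) _ ⟩
    ∑ (perms xs) (λ σ → ∑ (insertions x σ) (λ ρ → g (length ρ) ρ))
      ≡⟨ ∑-cong (perms xs) (λ σ → ∑-insertions-length x σ g) ⟩
    ∑ (perms xs) (λ σ → ∑ (insertions x σ) (g (suc (length σ))))
      ≡⟨ ∑-perms-length xs (λ m σ → ∑ (insertions x σ) (g (suc m))) ⟩
    ∑ (perms xs) (λ σ → ∑ (insertions x σ) (g (suc (length xs))))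
      ≡⟨ sym (∑-concatMap (insertions x) (perms xs) _) ⟩
    ∑ (concatMap (insertions x) (perms xs)) (g (suc (length xs))) ∎

  ∑-perms-const : (l : List X) (c : ℕ) → ∑ (perms l) (λ _ → c) ≡ length l ! * c
  ∑-perms-const []       c = refl
  ∑-perms-const (x ∷ xs) c = begin
    ∑ (concatMap (insertions x) (perms xs)) (λ _ → c)
      ≡⟨ ∑-concatMap (insertions x) (perms xs) _ ⟩
    ∑ (perms xs) (λ σ → ∑ (insertions x σ) (λ _ → c))
      ≡⟨ ∑-cong (perms xs) (λ σ → ∑-insertions-const x σ c) ⟩
    ∑ (perms xs) (λ σ → suc (length σ) * c)
      ≡⟨ ∑-perms-length xs (λ m _ → suc m * c) ⟩
    ∑ (perms xs) (λ _ → suc (length xs) * c)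
      ≡⟨ ∑-perms-const xs _ ⟩
    length xs ! * (suc (length xs) * c)
      ≡⟨ reorder (length xs !) (length xs) c ⟩
    suc (length xs) * length xs ! * c ∎
    where
    reorder : ∀ a m c → a * (suc m * c) ≡ suc m * a * c
    reorder = solve-∀

  -- In length σ ∸ j of the insertions x lands beyond the prefix; otherwise the prefix is an insertion into take j σ.
  ∑-insertions-take : (x : X) (σ : List X) (j : ℕ) (F : List X → ℕ) →
                      ∑ (insertions x σ) (λ ρ → F (take (suc j) ρ))
                        ≡ (length σ ∸ j) * F (take (suc j) σ) + ∑ (insertions x (take j σ)) F
  ∑-insertions-take x []       zero    F = refl
  ∑-insertions-take x []       (suc j) F = refl
  ∑-insertions-take x (y ∷ ys) zero    F = begin
    F (x ∷ []) + ∑ (map (y ∷_) (insertions x ys)) (λ ρ → F (take 1 ρ))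
      ≡⟨ cong (F (x ∷ []) +_) (trans (∑-map (y ∷_) (insertions x ys) _) (∑-insertions-const x ys (F (y ∷ [])))) ⟩
    F (x ∷ []) + suc (length ys) * F (y ∷ [])
      ≡⟨ reorder (F (x ∷ [])) _ ⟩
    suc (length ys) * F (y ∷ []) + (F (x ∷ []) + 0) ∎
    where
    reorder : ∀ a b → a + b ≡ b + (a + 0)
    reorder = solve-∀
  ∑-insertions-take x (y ∷ ys) (suc j) F = begin
    F (x ∷ y ∷ take j ys) + ∑ (map (y ∷_) (insertions x ys)) (λ ρ → F (take (suc (suc j)) ρ))
      ≡⟨ cong (F (x ∷ y ∷ take j ys) +_)
           (trans (∑-map (y ∷_) (insertions x ys) _) (∑-insertions-take x ys j (λ ρ → F (y ∷ ρ)))) ⟩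
    F (x ∷ y ∷ take j ys) + ((length ys ∸ j) * F (y ∷ take (suc j) ys) + ∑ (insertions x (take j ys)) (λ ρ → F (y ∷ ρ)))
      ≡⟨ reorder (F (x ∷ y ∷ take j ys)) ((length ys ∸ j) * F (y ∷ take (suc j) ys)) _ ⟩
    (length ys ∸ j) * F (y ∷ take (suc j) ys) + (F (x ∷ y ∷ take j ys) + ∑ (insertions x (take j ys)) (λ ρ → F (y ∷ ρ)))
      ≡⟨ cong (λ z → (length ys ∸ j) * F (y ∷ take (suc j) ys) + (F (x ∷ y ∷ take j ys) + z))
              (sym (∑-map (y ∷_) (insertions x (take j ys)) F)) ⟩
    (length ys ∸ j) * F (y ∷ take (suc j) ys) + (F (x ∷ y ∷ take j ys) + ∑ (map (y ∷_) (insertions x (take j ys))) F) ∎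
    where
    reorder : ∀ a b c → a + (b + c) ≡ b + (a + c)
    reorder = solve-∀

  arrangements-long : (j : ℕ) (l : List X) → length l < j → arrangements j l ≡ []
  arrangements-long (suc j) []       lt = refl
  arrangements-long (suc j) (x ∷ xs) (s≤s lt)
    rewrite arrangements-long (suc j) xs (m≤n⇒m≤1+n lt) | arrangements-long j xs lt = refl

  ∑-perms-take : (l : List X) (j : ℕ) → j ≤ length l → (F : List X → ℕ) →
                 ∑ (perms l) (λ σ → F (take j σ)) ≡ (length l ∸ j) ! * ∑ (arrangements j l) F
  ∑-perms-take l        zero    _        F =
    trans (∑-perms-const l (F [])) (cong (length l ! *_) (sym (+-identityʳ (F []))))
  ∑-perms-take (x ∷ xs) (suc j) (s≤s le) F = begin
    ∑ (concatMap (insertions x) (perms xs)) (λ σ → F (take (suc j) σ))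
      ≡⟨ ∑-concatMap (insertions x) (perms xs) _ ⟩
    ∑ (perms xs) (λ σ → ∑ (insertions x σ) (λ ρ → F (take (suc j) ρ)))
      ≡⟨ ∑-cong (perms xs) (λ σ → ∑-insertions-take x σ j F) ⟩
    ∑ (perms xs) (λ σ → (length σ ∸ j) * F (take (suc j) σ) + ∑ (insertions x (take j σ)) F)
      ≡⟨ ∑-perms-length xs (λ m σ → (m ∸ j) * F (take (suc j) σ) + ∑ (insertions x (take j σ)) F) ⟩
    ∑ (perms xs) (λ σ → (length xs ∸ j) * F (take (suc j) σ) + ∑ (insertions x (take j σ)) F)
      ≡⟨ ∑-+ (perms xs) _ _ ⟩
    ∑ (perms xs) (λ σ → (length xs ∸ j) * F (take (suc j) σ)) + ∑ (perms xs) (λ σ → ∑ (insertions x (take j σ)) F)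
      ≡⟨ cong₂ _+_ (trans (∑-*ˡ (length xs ∸ j) (perms xs) _) (longer (m≤n⇒m<n∨m≡n le)))
                   (∑-perms-take xs j le (λ p → ∑ (insertions x p) F)) ⟩
    (length xs ∸ j) ! * ∑ (arrangements (suc j) xs) F + (length xs ∸ j) ! * ∑ (arrangements j xs) (λ p → ∑ (insertions x p) F)
      ≡⟨ sym (*-distribˡ-+ ((length xs ∸ j) !) _ _) ⟩
    (length xs ∸ j) ! * (∑ (arrangements (suc j) xs) F + ∑ (arrangements j xs) (λ p → ∑ (insertions x p) F))
      ≡⟨ cong ((length xs ∸ j) ! *_) (sym (trans (∑-++ (arrangements (suc j) xs) _ F)
                                               (cong (∑ (arrangements (suc j) xs) F +_) (∑-concatMap (insertions x) (arrangements j xs) F)))) ⟩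
    (length xs ∸ j) ! * ∑ (arrangements (suc j) xs ++ concatMap (insertions x) (arrangements j xs)) F ∎
    where
    ∸-suc : (m j : ℕ) → j < m → m ∸ j ≡ suc (m ∸ suc j)
    ∸-suc (suc m) zero    _        = refl
    ∸-suc (suc m) (suc j) (s≤s lt) = ∸-suc m j lt
    longer : j < length xs ⊎ j ≡ length xs →
             (length xs ∸ j) * ∑ (perms xs) (λ σ → F (take (suc j) σ)) ≡ (length xs ∸ j) ! * ∑ (arrangements (suc j) xs) F
    longer (inj₁ lt) = begin
      (length xs ∸ j) * ∑ (perms xs) (λ σ → F (take (suc j) σ))
        ≡⟨ cong ((length xs ∸ j) *_) (∑-perms-take xs (suc j) lt F) ⟩
      (length xs ∸ j) * ((length xs ∸ suc j) ! * ∑ (arrangements (suc j) xs) F)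
        ≡⟨ sym (*-assoc (length xs ∸ j) _ _) ⟩
      (length xs ∸ j) * (length xs ∸ suc j) ! * ∑ (arrangements (suc j) xs) F
        ≡⟨ cong (λ m → m * (length xs ∸ suc j) ! * ∑ (arrangements (suc j) xs) F) (∸-suc (length xs) j lt) ⟩
      suc (length xs ∸ suc j) ! * ∑ (arrangements (suc j) xs) F
        ≡⟨ cong (λ m → m ! * ∑ (arrangements (suc j) xs) F) (sym (∸-suc (length xs) j lt)) ⟩
      (length xs ∸ j) ! * ∑ (arrangements (suc j) xs) F ∎
    longer (inj₂ refl) rewrite n∸n≡0 (length xs) | arrangements-long (suc (length xs)) xs ≤-refl = refl

module _ {n : ℕ} where

  infix 4 _⊆ᵇ_

  _⊆ᵇ_ : List (Fin n) → List (Fin n) → Set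
  q ⊆ᵇ xs = ∀ z → z ∈ᵇ q ≡ true → z ∈ᵇ xs ≡ true

  []⊆ᵇ : (xs : List (Fin n)) → [] ⊆ᵇ xs
  []⊆ᵇ xs z z∈[] with trans (sym (∈ᵇ-[] z)) z∈[]
  ... | ()

  ∉-⊆ᵇ : (x : Fin n) {q xs : List (Fin n)} → x ∈ᵇ xs ≡ false → q ⊆ᵇ xs → x ∈ᵇ q ≡ false
  ∉-⊆ᵇ x {q} x∉xs q⊆xs with x ∈ᵇ q in x∈q
  ... | false = refl
  ... | true  = trans (sym (q⊆xs x x∈q)) x∉xs

  ∑-insertions-cong : (x : Fin n) (q : List (Fin n)) {f g : List (Fin n) → ℕ} →
    (∀ ρ → (∀ z → z ∈ᵇ ρ ≡ x ≡ᵇ z ∨ z ∈ᵇ q) → (x ∈ᵇ q ≡ false → Distinct q → Distinct ρ) →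
           length ρ ≡ suc (length q) → f ρ ≡ g ρ) →
    ∑ (insertions x q) f ≡ ∑ (insertions x q) g
  ∑-insertions-cong x []       e = cong (_+ 0) (e (x ∷ []) (λ z → ∈ᵇ-∷ z x []) (λ x∉ _ → x∉ , tt) refl)
  ∑-insertions-cong x (y ∷ ys) {f} {g} e = cong₂ _+_
    (e (x ∷ y ∷ ys) (λ z → ∈ᵇ-∷ z x (y ∷ ys)) _,_ refl)
    (trans (∑-map (y ∷_) (insertions x ys) f) (trans
      (∑-insertions-cong x ys (λ ρ ∈ρ dρ lρ → e (y ∷ ρ) (∈ᵇ-y∷ρ ρ ∈ρ) (distinct-y∷ρ ρ ∈ρ dρ) (cong suc lρ)))
      (sym (∑-map (y ∷_) (insertions x ys) g))))
    where
    ∈ᵇ-y∷ρ : ∀ ρ → (∀ z → z ∈ᵇ ρ ≡ x ≡ᵇ z ∨ z ∈ᵇ ys) → ∀ z → z ∈ᵇ (y ∷ ρ) ≡ x ≡ᵇ z ∨ z ∈ᵇ (y ∷ ys)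
    ∈ᵇ-y∷ρ ρ ∈ρ z rewrite ∈ᵇ-∷ z y ρ | ∈ᵇ-∷ z y ys | ∈ρ z =
      trans (sym (∨-assoc (y ≡ᵇ z) (x ≡ᵇ z) (z ∈ᵇ ys)))
      (trans (cong (_∨ z ∈ᵇ ys) (∨-comm (y ≡ᵇ z) (x ≡ᵇ z))) (∨-assoc (x ≡ᵇ z) (y ≡ᵇ z) (z ∈ᵇ ys)))
    distinct-y∷ρ : ∀ ρ → (∀ z → z ∈ᵇ ρ ≡ x ≡ᵇ z ∨ z ∈ᵇ ys) → (x ∈ᵇ ys ≡ false → Distinct ys → Distinct ρ) →
                   x ∈ᵇ (y ∷ ys) ≡ false → Distinct (y ∷ ys) → Distinct (y ∷ ρ)
    distinct-y∷ρ ρ ∈ρ dρ x∉ (y∉ys , dys) with ∨≡false (y ≡ᵇ x) (x ∈ᵇ ys) (trans (sym (∈ᵇ-∷ x y ys)) x∉)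
    ... | y≢x , x∉ys = trans (∈ρ y) (trans (cong (_∨ y ∈ᵇ ys) (trans (≡ᵇ-sym x y) y≢x)) y∉ys) , dρ x∉ys dys

  ∑-arrangements-cong : (j : ℕ) (xs : List (Fin n)) {f g : List (Fin n) → ℕ} → Distinct xs →
    (∀ q → q ⊆ᵇ xs → Distinct q → length q ≡ j → f q ≡ g q) →
    ∑ (arrangements j xs) f ≡ ∑ (arrangements j xs) g
  ∑-arrangements-cong zero    xs       _ e = cong (_+ 0) (e [] ([]⊆ᵇ xs) tt refl)
  ∑-arrangements-cong (suc j) []       _ e = refl
  ∑-arrangements-cong (suc j) (x ∷ xs) {f} {g} (x∉xs , d) e = begin
    ∑ (arrangements (suc j) xs ++ concatMap (insertions x) (arrangements j xs)) f
      ≡⟨ ∑-++ (arrangements (suc j) xs) _ f ⟩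
    ∑ (arrangements (suc j) xs) f + ∑ (concatMap (insertions x) (arrangements j xs)) f
      ≡⟨ cong₂ _+_ (∑-arrangements-cong (suc j) xs d (λ q q⊆xs → e q (⊆ᵇ-∷ q q⊆xs)))
           (trans (∑-concatMap (insertions x) (arrangements j xs) f) (trans
              (∑-arrangements-cong j xs d (λ q q⊆xs dq lq → ∑-insertions-cong x q (λ ρ ∈ρ dρ lρ →
                 e ρ (⊆ᵇ-insert q q⊆xs ρ ∈ρ) (dρ (∉-⊆ᵇ x {q} {xs} x∉xs q⊆xs) dq) (trans lρ (cong suc lq)))))
              (sym (∑-concatMap (insertions x) (arrangements j xs) g)))) ⟩
    ∑ (arrangements (suc j) xs) g + ∑ (concatMap (insertions x) (arrangements j xs)) g
      ≡⟨ sym (∑-++ (arrangements (suc j) xs) _ g) ⟩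
    ∑ (arrangements (suc j) xs ++ concatMap (insertions x) (arrangements j xs)) g ∎
    where
    ⊆ᵇ-∷ : ∀ q → q ⊆ᵇ xs → q ⊆ᵇ x ∷ xs
    ⊆ᵇ-∷ q q⊆xs z z∈q rewrite ∈ᵇ-∷ z x xs | q⊆xs z z∈q = ∨-zeroʳ (x ≡ᵇ z)
    ⊆ᵇ-insert : ∀ q → q ⊆ᵇ xs → ∀ ρ → (∀ z → z ∈ᵇ ρ ≡ x ≡ᵇ z ∨ z ∈ᵇ q) → ρ ⊆ᵇ x ∷ xs
    ⊆ᵇ-insert q q⊆xs ρ ∈ρ z z∈ρ with ∨≡true (x ≡ᵇ z) (z ∈ᵇ q) (trans (sym (∈ρ z)) z∈ρ)
    ... | inj₁ x≡z = trans (∈ᵇ-∷ z x xs) (cong (_∨ z ∈ᵇ xs) x≡z)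
    ... | inj₂ z∈q = trans (∈ᵇ-∷ z x xs) (trans (cong (x ≡ᵇ z ∨_) (q⊆xs z z∈q)) (∨-zeroʳ (x ≡ᵇ z)))

  ∑-insertions-∷ʳ : (x : Fin n) (q : List (Fin n)) (y : Fin n) (G : List (Fin n) → ℕ) →
    ∑ (insertions x (q ++ [ y ])) G ≡ ∑ (insertions x q) (λ ρ → G (ρ ++ [ y ])) + G (q ++ y ∷ x ∷ [])
  ∑-insertions-∷ʳ x []       y G = reorder (G (x ∷ y ∷ [])) (G (y ∷ x ∷ []))
    where
    reorder : ∀ a b → a + (b + 0) ≡ a + 0 + b
    reorder = solve-∀
  ∑-insertions-∷ʳ x (z ∷ zs) y G = begin
    G (x ∷ z ∷ zs ++ [ y ]) + ∑ (map (z ∷_) (insertions x (zs ++ [ y ]))) G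
      ≡⟨ cong (G (x ∷ z ∷ zs ++ [ y ]) +_)
           (trans (∑-map (z ∷_) (insertions x (zs ++ [ y ])) G) (∑-insertions-∷ʳ x zs y (λ ρ → G (z ∷ ρ)))) ⟩
    G (x ∷ z ∷ zs ++ [ y ]) + (∑ (insertions x zs) (λ ρ → G (z ∷ ρ ++ [ y ])) + G (z ∷ zs ++ y ∷ x ∷ []))
      ≡⟨ sym (+-assoc (G (x ∷ z ∷ zs ++ [ y ])) _ _) ⟩
    G (x ∷ z ∷ zs ++ [ y ]) + ∑ (insertions x zs) (λ ρ → G (z ∷ ρ ++ [ y ])) + G (z ∷ zs ++ y ∷ x ∷ [])
      ≡⟨ cong (λ w → G (x ∷ z ∷ zs ++ [ y ]) + w + G (z ∷ zs ++ y ∷ x ∷ []))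
              (sym (∑-map (z ∷_) (insertions x zs) (λ ρ → G (ρ ++ [ y ])))) ⟩
    G (x ∷ z ∷ zs ++ [ y ]) + ∑ (map (z ∷_) (insertions x zs)) (λ ρ → G (ρ ++ [ y ])) + G (z ∷ zs ++ y ∷ x ∷ []) ∎

  ∑[_∖_] : List (Fin n) → List (Fin n) → (Fin n → ℕ) → ℕ
  ∑[ l ∖ q ] F = ∑ (allFin n) (λ y → ⟦ y ∈ᵇ l ∧ not (y ∈ᵇ q) ⟧ * F y)

  ∑∖-∷ : (x : Fin n) (xs q : List (Fin n)) → x ∈ᵇ xs ≡ false → q ⊆ᵇ xs → (F : Fin n → ℕ) →
         ∑[ x ∷ xs ∖ q ] F ≡ F x + ∑[ xs ∖ q ] F
  ∑∖-∷ x xs q x∉xs q⊆xs F = begin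
    ∑ (allFin n) (λ y → ⟦ y ∈ᵇ (x ∷ xs) ∧ not (y ∈ᵇ q) ⟧ * F y)
      ≡⟨ ∑-cong (allFin n) split ⟩
    ∑ (allFin n) (λ y → ⟦ x ≡ᵇ y ⟧ * F y + ⟦ y ∈ᵇ xs ∧ not (y ∈ᵇ q) ⟧ * F y)
      ≡⟨ ∑-+ (allFin n) _ _ ⟩
    ∑ (allFin n) (λ y → ⟦ x ≡ᵇ y ⟧ * F y) + ∑[ xs ∖ q ] F
      ≡⟨ cong (_+ ∑[ xs ∖ q ] F) (∑-δ x F) ⟩
    F x + ∑[ xs ∖ q ] F ∎
    where
    split : ∀ y → ⟦ y ∈ᵇ (x ∷ xs) ∧ not (y ∈ᵇ q) ⟧ * F y ≡ ⟦ x ≡ᵇ y ⟧ * F y + ⟦ y ∈ᵇ xs ∧ not (y ∈ᵇ q) ⟧ * F y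
    split y rewrite ∈ᵇ-∷ y x xs with x ≟ᶠ y
    ... | yes refl rewrite ≡ᵇ-refl x | x∉xs | ∉-⊆ᵇ x {q} {xs} x∉xs q⊆xs = sym (+-identityʳ _)
    ... | no x≢y   rewrite ≢⇒≡ᵇ-false x≢y = refl

  ∑∖-insert : (x : Fin n) (xs q ρ : List (Fin n)) → x ∈ᵇ xs ≡ false →
              (∀ z → z ∈ᵇ ρ ≡ x ≡ᵇ z ∨ z ∈ᵇ q) → (F : Fin n → ℕ) →
              ∑[ x ∷ xs ∖ ρ ] F ≡ ∑[ xs ∖ q ] F
  ∑∖-insert x xs q ρ x∉xs ∈ρ F = ∑-cong (allFin n) same
    where
    same : ∀ y → ⟦ y ∈ᵇ (x ∷ xs) ∧ not (y ∈ᵇ ρ) ⟧ * F y ≡ ⟦ y ∈ᵇ xs ∧ not (y ∈ᵇ q) ⟧ * F y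
    same y rewrite ∈ᵇ-∷ y x xs | ∈ρ y with x ≟ᶠ y
    ... | yes refl rewrite ≡ᵇ-refl x | x∉xs = refl
    ... | no x≢y   rewrite ≢⇒≡ᵇ-false x≢y = refl

  ∑∖-insertions : (x : Fin n) (xs q : List (Fin n)) (G : List (Fin n) → ℕ) →
    ∑[ xs ∖ q ] (λ y → ∑ (insertions x (q ++ [ y ])) G)
      ≡ ∑ (insertions x q) (λ ρ → ∑[ xs ∖ q ] (λ y → G (ρ ++ [ y ]))) + ∑[ xs ∖ q ] (λ y → G ((q ++ [ y ]) ++ [ x ]))
  ∑∖-insertions x xs q G = begin
    ∑ (allFin n) (λ y → c y * ∑ (insertions x (q ++ [ y ])) G)
      ≡⟨ ∑-cong (allFin n) (λ y → cong (c y *_) (∑-insertions-∷ʳ x q y G)) ⟩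
    ∑ (allFin n) (λ y → c y * (∑ (insertions x q) (λ ρ → G (ρ ++ [ y ])) + G (q ++ y ∷ x ∷ [])))
      ≡⟨ ∑-cong (allFin n) (λ y → *-distribˡ-+ (c y) _ _) ⟩
    ∑ (allFin n) (λ y → c y * ∑ (insertions x q) (λ ρ → G (ρ ++ [ y ])) + c y * G (q ++ y ∷ x ∷ []))
      ≡⟨ ∑-+ (allFin n) _ _ ⟩
    ∑ (allFin n) (λ y → c y * ∑ (insertions x q) (λ ρ → G (ρ ++ [ y ]))) + ∑ (allFin n) (λ y → c y * G (q ++ y ∷ x ∷ []))
      ≡⟨ cong₂ _+_ (trans (∑-cong (allFin n) (λ y → sym (∑-*ˡ (c y) (insertions x q) _)))
                          (∑-swap (allFin n) (insertions x q) _))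
                   (∑-cong (allFin n) (λ y → cong (λ p → c y * G p) (sym (List.++-assoc q [ y ] [ x ])))) ⟩
    ∑ (insertions x q) (λ ρ → ∑[ xs ∖ q ] (λ y → G (ρ ++ [ y ]))) + ∑[ xs ∖ q ] (λ y → G ((q ++ [ y ]) ++ [ x ])) ∎
    where
    c : Fin n → ℕ
    c y = ⟦ y ∈ᵇ xs ∧ not (y ∈ᵇ q) ⟧

  ∑-extensions-∷ : (x : Fin n) (xs : List (Fin n)) → x ∈ᵇ xs ≡ false → Distinct xs → (j : ℕ) (G : List (Fin n) → ℕ) →
    ∑ (arrangements (suc j) (x ∷ xs)) (λ q → ∑[ x ∷ xs ∖ q ] (λ y → G (q ++ [ y ])))
      ≡ ∑ (arrangements (suc j) xs) (λ q → G (q ++ [ x ]) + ∑[ xs ∖ q ] (λ y → G (q ++ [ y ])))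
        + ∑ (arrangements j xs) (λ q → ∑ (insertions x q) (λ ρ → ∑[ xs ∖ q ] (λ y → G (ρ ++ [ y ]))))
  ∑-extensions-∷ x xs x∉xs d j G = trans (∑-++ (arrangements (suc j) xs) _ _) (cong₂ _+_
    (∑-arrangements-cong (suc j) xs d (λ q q⊆xs _ _ → ∑∖-∷ x xs q x∉xs q⊆xs _))
    (trans (∑-concatMap (insertions x) (arrangements j xs) _)
           (∑-arrangements-cong j xs d (λ q _ _ _ → ∑-insertions-cong x q (λ ρ ∈ρ _ _ →
              ∑∖-insert x xs q ρ x∉xs ∈ρ (λ y → G (ρ ++ [ y ])))))))

  ∑-arrangements-suc : (l : List (Fin n)) → Distinct l → (j : ℕ) (G : List (Fin n) → ℕ) →
    ∑ (arrangements (suc j) l) G ≡ ∑ (arrangements j l) (λ q → ∑[ l ∖ q ] (λ y → G (q ++ [ y ])))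
  ∑-arrangements-suc [] _ j G = sym (trans
    (∑-cong (arrangements j []) (λ q → trans
      (∑-cong (allFin n) (λ y → cong (λ b → ⟦ b ∧ not (y ∈ᵇ q) ⟧ * G (q ++ [ y ])) (∈ᵇ-[] y)))
      (∑-zero (allFin n))))
    (∑-zero (arrangements j [])))
  ∑-arrangements-suc (x ∷ xs) (x∉xs , d) zero G = begin
    ∑ (arrangements 1 xs ++ [ x ] ∷ []) G
      ≡⟨ ∑-++ (arrangements 1 xs) _ G ⟩
    ∑ (arrangements 1 xs) G + (G (x ∷ []) + 0)
      ≡⟨ cong₂ _+_ (∑-arrangements-suc xs d zero G) (+-identityʳ _) ⟩
    ∑[ xs ∖ [] ] (λ y → G [ y ]) + 0 + G (x ∷ [])
      ≡⟨ reorder (∑[ xs ∖ [] ] (λ y → G [ y ])) _ ⟩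
    G (x ∷ []) + ∑[ xs ∖ [] ] (λ y → G [ y ]) + 0
      ≡⟨ cong (_+ 0) (sym (∑∖-∷ x xs [] x∉xs ([]⊆ᵇ xs) (λ y → G [ y ]))) ⟩
    ∑[ x ∷ xs ∖ [] ] (λ y → G [ y ]) + 0 ∎
    where
    reorder : ∀ a b → a + 0 + b ≡ b + a + 0
    reorder = solve-∀
  ∑-arrangements-suc (x ∷ xs) (x∉xs , d) (suc j) G = begin
    ∑ (A (suc (suc j)) ++ concatMap (insertions x) (A (suc j))) G
      ≡⟨ trans (∑-++ (A (suc (suc j))) _ G) (cong₂ _+_ (∑-arrangements-suc xs d (suc j) G) (∑-concatMap (insertions x) (A (suc j)) G)) ⟩
    ∑ (A (suc j)) (E xs G) + ∑ (A (suc j)) (λ q → ∑ (insertions x q) G)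
      ≡⟨ cong (∑ (A (suc j)) (E xs G) +_) (∑-arrangements-suc xs d j (λ q → ∑ (insertions x q) G)) ⟩
    ∑ (A (suc j)) (E xs G) + ∑ (A j) (λ q → ∑[ xs ∖ q ] (λ y → ∑ (insertions x (q ++ [ y ])) G))
      ≡⟨ cong (∑ (A (suc j)) (E xs G) +_) (trans (∑-cong (A j) (λ q → ∑∖-insertions x xs q G)) (∑-+ (A j) _ _)) ⟩
    ∑ (A (suc j)) (E xs G) + (∑ (A j) (λ q → ∑ (insertions x q) (Eρ q)) + ∑ (A j) (E xs (λ p → G (p ++ [ x ]))))
      ≡⟨ cong (λ w → ∑ (A (suc j)) (E xs G) + (∑ (A j) (λ q → ∑ (insertions x q) (Eρ q)) + w))
              (sym (∑-arrangements-suc xs d j (λ p → G (p ++ [ x ])))) ⟩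
    ∑ (A (suc j)) (E xs G) + (∑ (A j) (λ q → ∑ (insertions x q) (Eρ q)) + ∑ (A (suc j)) (λ p → G (p ++ [ x ])))
      ≡⟨ reorder (∑ (A (suc j)) (E xs G)) (∑ (A j) (λ q → ∑ (insertions x q) (Eρ q))) _ ⟩
    (∑ (A (suc j)) (λ p → G (p ++ [ x ])) + ∑ (A (suc j)) (E xs G)) + ∑ (A j) (λ q → ∑ (insertions x q) (Eρ q))
      ≡⟨ cong (_+ ∑ (A j) (λ q → ∑ (insertions x q) (Eρ q))) (sym (∑-+ (A (suc j)) _ _)) ⟩
    ∑ (A (suc j)) (λ q → G (q ++ [ x ]) + E xs G q) + ∑ (A j) (λ q → ∑ (insertions x q) (Eρ q))
      ≡⟨ sym (∑-extensions-∷ x xs x∉xs d j G) ⟩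
    ∑ (arrangements (suc j) (x ∷ xs)) (E (x ∷ xs) G) ∎
    where
    A : ℕ → List (List (Fin n))
    A i = arrangements i xs
    E : List (Fin n) → (List (Fin n) → ℕ) → List (Fin n) → ℕ
    E l G' q = ∑[ l ∖ q ] (λ y → G' (q ++ [ y ]))
    Eρ : List (Fin n) → List (Fin n) → ℕ
    Eρ q ρ = ∑[ xs ∖ q ] (λ y → G (ρ ++ [ y ]))
    reorder : ∀ a b c → a + (b + c) ≡ (c + a) + b
    reorder = solve-∀

setOf-map-suc : ∀ {n} (l : List (Fin n)) → setOf (map suc l) ≡ false ∷ setOf l
setOf-map-suc []      = refl
setOf-map-suc (x ∷ l) = cong (zipWith _∨_ ⁅ suc x ⁆) (setOf-map-suc l)

Distinct-map-suc : ∀ {n} (l : List (Fin n)) → Distinct l → Distinct (map suc l)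
Distinct-map-suc []      _            = tt
Distinct-map-suc (x ∷ l) (x∉l , d) =
  trans (cong (λ S → lookup S (suc x)) (setOf-map-suc l)) x∉l , Distinct-map-suc l d

allFin-suc : ∀ n → allFin (suc n) ≡ zero ∷ map suc (allFin n)
allFin-suc n = cong (zero ∷_) (sym (List.map-tabulate (λ x → x) suc))

Distinct-allFin : ∀ n → Distinct (allFin n)
Distinct-allFin zero    = tt
Distinct-allFin (suc n) = subst Distinct (sym (allFin-suc n))
  (cong (λ S → lookup S zero) (setOf-map-suc (allFin n)) , Distinct-map-suc (allFin n) (Distinct-allFin n))

∈ᵇ-allFin : ∀ {n} (z : Fin n) → z ∈ᵇ allFin n ≡ true
∈ᵇ-allFin {suc n} z = subst (λ l → z ∈ᵇ l ≡ true) (sym (allFin-suc n))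
  (trans (∈ᵇ-∷ z zero (map suc (allFin n)))
    (trans (cong (λ S → zero ≡ᵇ z ∨ lookup S z) (setOf-map-suc (allFin n))) (later z)))
  where
  later : ∀ z → zero ≡ᵇ z ∨ lookup (false ∷ setOf (allFin n)) z ≡ true
  later zero    = refl
  later (suc z) = ∈ᵇ-allFin z

module _ {n : ℕ} where

  ∈ᵇ-∷ʳ-minus : (q : List (Fin n)) (y : Fin n) (V : Subset n) → lookup V y ≡ true → setOf q ≡ V - y →
                ∀ z → z ∈ᵇ (q ++ [ y ]) ≡ lookup V z
  ∈ᵇ-∷ʳ-minus q y V y∈V q≡V-y z = trans (∈ᵇ-∷ʳ z q y) (trans (cong (λ S → lookup S z ∨ y ≡ᵇ z) q≡V-y)
    (trans (cong (_∨ y ≡ᵇ z) (lookup-minus V y z))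
           (restore (lookup V z) (y ≡ᵇ z) (λ y≡z → subst (λ w → lookup V w ≡ true) (≡ᵇ⇒≡ y≡z) y∈V))))
    where
    restore : ∀ a b → (b ≡ true → a ≡ true) → (a ∧ not b) ∨ b ≡ a
    restore a false _ rewrite ∧-identityʳ a | ∨-identityʳ a = refl
    restore a true  f rewrite f refl = refl

  setOf-∷ʳ : (q : List (Fin n)) (y : Fin n) (V : Subset n) → lookup V y ≡ true → setOf q ≡ V - y →
             setOf (q ++ [ y ]) ≡ V
  setOf-∷ʳ q y V y∈V q≡V-y = Subset-ext (setOf (q ++ [ y ])) V (∈ᵇ-∷ʳ-minus q y V y∈V q≡V-y)

  setOf-∷ʳ-minus : (q : List (Fin n)) (y : Fin n) → y ∈ᵇ q ≡ false → setOf q ≡ setOf (q ++ [ y ]) - y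
  setOf-∷ʳ-minus q y y∉q = Subset-ext _ _ same
    where
    same : ∀ z → z ∈ᵇ q ≡ lookup (setOf (q ++ [ y ]) - y) z
    same z rewrite lookup-minus (setOf (q ++ [ y ])) y z | ∈ᵇ-∷ʳ z q y with y ≟ᶠ z
    ... | yes refl rewrite ≡ᵇ-refl y | ∨-zeroʳ (y ∈ᵇ q) = y∉q
    ... | no y≢z   rewrite ≢⇒≡ᵇ-false y≢z | ∨-identityʳ (z ∈ᵇ q) | ∧-identityʳ (z ∈ᵇ q) = refl

  sameSet-∷ʳ : (q : List (Fin n)) (y : Fin n) (V : Subset n) →
               not (y ∈ᵇ q) ∧ sameSet (setOf (q ++ [ y ])) V ≡ lookup V y ∧ sameSet (setOf q) (V - y)
  sameSet-∷ʳ q y V = true⇔true⇒≡ _ _ forth back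
    where
    forth : not (y ∈ᵇ q) ∧ sameSet (setOf (q ++ [ y ])) V ≡ true → lookup V y ∧ sameSet (setOf q) (V - y) ≡ true
    forth h with ∧≡true _ _ h
    ... | y∉q , q∷y≈V with sameSet⇒≡ (setOf (q ++ [ y ])) V q∷y≈V
    ... | refl rewrite ∈ᵇ-∷ʳ y q y | ≡ᵇ-refl y | ∨-zeroʳ (y ∈ᵇ q)
                     | sym (setOf-∷ʳ-minus q y (not≡true _ y∉q)) | sameSet-refl (setOf q) = refl
    back : lookup V y ∧ sameSet (setOf q) (V - y) ≡ true → not (y ∈ᵇ q) ∧ sameSet (setOf (q ++ [ y ])) V ≡ true
    back h with ∧≡true _ _ h
    ... | y∈V , q≈V-y with sameSet⇒≡ (setOf q) (V - y) q≈V-y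
    ... | q≡V-y rewrite setOf-∷ʳ q y V y∈V q≡V-y | sameSet-refl V
                      | q≡V-y | lookup-minus V y y | ≡ᵇ-refl y | ∧-zeroʳ (lookup V y) = refl

  ∑-arrangements-last : (V : Subset n) (j : ℕ) (G : List (Fin n) → ℕ) →
    ∑ (arrangements (suc j) (allFin n)) (λ p → ⟦ sameSet (setOf p) V ⟧ * G p)
      ≡ ∑ (allFin n) (λ y → ⟦ lookup V y ⟧ * ∑ (arrangements j (allFin n)) (λ q → ⟦ sameSet (setOf q) (V - y) ⟧ * G (q ++ [ y ])))
  ∑-arrangements-last V j G = begin
    ∑ (arrangements (suc j) (allFin n)) (λ p → ⟦ sameSet (setOf p) V ⟧ * G p)
      ≡⟨ ∑-arrangements-suc (allFin n) (Distinct-allFin n) j _ ⟩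
    ∑ (arrangements j (allFin n)) (λ q → ∑[ allFin n ∖ q ] (λ y → ⟦ sameSet (setOf (q ++ [ y ])) V ⟧ * G (q ++ [ y ])))
      ≡⟨ ∑-cong (arrangements j (allFin n)) (λ q → ∑-cong (allFin n) (λ y → last-is-y q y)) ⟩
    ∑ (arrangements j (allFin n)) (λ q → ∑ (allFin n) (λ y → ⟦ lookup V y ⟧ * (⟦ sameSet (setOf q) (V - y) ⟧ * G (q ++ [ y ]))))
      ≡⟨ ∑-swap (arrangements j (allFin n)) (allFin n) _ ⟩
    ∑ (allFin n) (λ y → ∑ (arrangements j (allFin n)) (λ q → ⟦ lookup V y ⟧ * (⟦ sameSet (setOf q) (V - y) ⟧ * G (q ++ [ y ]))))
      ≡⟨ ∑-cong (allFin n) (λ y → ∑-*ˡ ⟦ lookup V y ⟧ (arrangements j (allFin n)) _) ⟩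
    ∑ (allFin n) (λ y → ⟦ lookup V y ⟧ * ∑ (arrangements j (allFin n)) (λ q → ⟦ sameSet (setOf q) (V - y) ⟧ * G (q ++ [ y ]))) ∎
    where
    last-is-y : ∀ q y → ⟦ y ∈ᵇ allFin n ∧ not (y ∈ᵇ q) ⟧ * (⟦ sameSet (setOf (q ++ [ y ])) V ⟧ * G (q ++ [ y ]))
                          ≡ ⟦ lookup V y ⟧ * (⟦ sameSet (setOf q) (V - y) ⟧ * G (q ++ [ y ]))
    last-is-y q y = begin
      ⟦ y ∈ᵇ allFin n ∧ not (y ∈ᵇ q) ⟧ * (⟦ sameSet (setOf (q ++ [ y ])) V ⟧ * G (q ++ [ y ]))
        ≡⟨ cong (λ b → ⟦ b ∧ not (y ∈ᵇ q) ⟧ * (⟦ sameSet (setOf (q ++ [ y ])) V ⟧ * G (q ++ [ y ]))) (∈ᵇ-allFin y) ⟩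
      ⟦ not (y ∈ᵇ q) ⟧ * (⟦ sameSet (setOf (q ++ [ y ])) V ⟧ * G (q ++ [ y ]))
        ≡⟨ sym (*-assoc ⟦ not (y ∈ᵇ q) ⟧ _ _) ⟩
      ⟦ not (y ∈ᵇ q) ⟧ * ⟦ sameSet (setOf (q ++ [ y ])) V ⟧ * G (q ++ [ y ])
        ≡⟨ cong (_* G (q ++ [ y ])) (trans (sym (⟦∧⟧ (not (y ∈ᵇ q)) _)) (trans (cong ⟦_⟧ (sameSet-∷ʳ q y V)) (⟦∧⟧ (lookup V y) _))) ⟩
      ⟦ lookup V y ⟧ * ⟦ sameSet (setOf q) (V - y) ⟧ * G (q ++ [ y ])
        ≡⟨ *-assoc ⟦ lookup V y ⟧ _ _ ⟩
      ⟦ lookup V y ⟧ * (⟦ sameSet (setOf q) (V - y) ⟧ * G (q ++ [ y ])) ∎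

  ∑-arrangements-sameSet : (j : ℕ) (V : Subset n) → ∣ V ∣ ≡ j →
                           ∑ (arrangements j (allFin n)) (λ p → ⟦ sameSet (setOf p) V ⟧) ≡ j !
  ∑-arrangements-sameSet zero    V ∣V∣≡0 rewrite ∣p∣≡0⇒p≡⊥ V ∣V∣≡0 | sameSet-refl (⊥ {n}) = refl
  ∑-arrangements-sameSet (suc j) V ∣V∣≡1+j = begin
    ∑ (arrangements (suc j) (allFin n)) (λ p → ⟦ sameSet (setOf p) V ⟧)
      ≡⟨ ∑-cong (arrangements (suc j) (allFin n)) (λ p → sym (*-identityʳ _)) ⟩
    ∑ (arrangements (suc j) (allFin n)) (λ p → ⟦ sameSet (setOf p) V ⟧ * 1)
      ≡⟨ ∑-arrangements-last V j (λ _ → 1) ⟩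
    ∑ (allFin n) (λ y → ⟦ lookup V y ⟧ * ∑ (arrangements j (allFin n)) (λ q → ⟦ sameSet (setOf q) (V - y) ⟧ * 1))
      ≡⟨ ∑-cong (allFin n) (λ y → ⟦⟧*-cong (lookup V y) (λ y∈V → trans
           (∑-cong (arrangements j (allFin n)) (λ q → *-identityʳ _))
           (∑-arrangements-sameSet j (V - y) (suc-injective (trans (suc∣p-x∣≡∣p∣ V y y∈V) ∣V∣≡1+j))))) ⟩
    ∑ (allFin n) (λ y → ⟦ lookup V y ⟧ * j !)
      ≡⟨ ∑-*ʳ (j !) (allFin n) _ ⟩
    ∑ (allFin n) (λ y → ⟦ lookup V y ⟧) * j !
      ≡⟨ cong (_* j !) (trans (sym (∣p∣≡∑ V)) ∣V∣≡1+j) ⟩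
    suc j ! ∎

  ∑-arrangements-sameSet-cong : (j : ℕ) (W : Subset n) {f g : List (Fin n) → ℕ} →
    (∀ q → length q ≡ j → Distinct q → setOf q ≡ W → f q ≡ g q) →
    ∑ (arrangements j (allFin n)) (λ q → ⟦ sameSet (setOf q) W ⟧ * f q)
      ≡ ∑ (arrangements j (allFin n)) (λ q → ⟦ sameSet (setOf q) W ⟧ * g q)
  ∑-arrangements-sameSet-cong j W e = ∑-arrangements-cong j (allFin n) (Distinct-allFin n)
    (λ q _ dq lq → ⟦⟧*-cong (sameSet (setOf q) W) (λ q≈W → e q lq dq (sameSet⇒≡ (setOf q) W q≈W)))

-- Unfolding Algorithm VA

≤-induction : (P : ℕ → Set) (k : ℕ) → P k → (∀ t → k ≤ t → P t → P (suc t)) → ∀ t → k ≤ t → P t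
≤-induction P k base step zero    z≤n = base
≤-induction P k base step (suc t) k≤1+t with m≤n⇒m<n∨m≡n k≤1+t
... | inj₂ refl     = base
... | inj₁ (s≤s k≤t) = step t k≤t (≤-induction P k base step t k≤t)

take-take≤ : {A : Set} (s t : ℕ) (l : List A) → s ≤ t → take s (take t l) ≡ take s l
take-take≤ s t l s≤t = trans (List.take-take s t l) (cong (λ m → take m l) (m≤n⇒m⊓n≡m s≤t))

nth-take : {A : Set} (t i : ℕ) (l : List A) → i < t → nth (take t l) i ≡ nth l i
nth-take (suc t) i       []      _        = refl
nth-take (suc t) zero    (x ∷ l) _        = refl
nth-take (suc t) (suc i) (x ∷ l) (s≤s lt) = nth-take t i l lt

module _ {A : Set} where

  nth-∷ʳ : (q : List A) (y : A) → nth (q ++ [ y ]) (length q) ≡ just y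
  nth-∷ʳ []      y = refl
  nth-∷ʳ (x ∷ q) y = nth-∷ʳ q y

  take-length-++ : (q ys : List A) → take (length q) (q ++ ys) ≡ q
  take-length-++ []      ys = refl
  take-length-++ (x ∷ q) ys = cong (x ∷_) (take-length-++ q ys)

  take-suc-length-∷ʳ : (q : List A) (y : A) → take (suc (length q)) (q ++ [ y ]) ≡ q ++ [ y ]
  take-suc-length-∷ʳ []      y = refl
  take-suc-length-∷ʳ (x ∷ q) y = cong (x ∷_) (take-suc-length-∷ʳ q y)

  take-suc-just : (σ : List A) (t : ℕ) {v : A} → nth σ t ≡ just v → take (suc t) σ ≡ take t σ ++ [ v ]
  take-suc-just (x ∷ σ) zero    refl = refl
  take-suc-just (x ∷ σ) (suc t) e    = cong (x ∷_) (take-suc-just σ t e)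

  take-suc-nothing : (σ : List A) (t : ℕ) → nth σ t ≡ nothing → take (suc t) σ ≡ take t σ
  take-suc-nothing []      t       _ = sym (List.take-[] t)
  take-suc-nothing (x ∷ σ) (suc t) e = cong (x ∷_) (take-suc-nothing σ t e)

choice : List ℕ → ℕ → ℕ
choice τ t = maybe (λ r → r) 0 (nth τ t)

matchStep : ∀ {n} → Fin n → Fin n → List (Fin n) → Subset n → Subset n
matchStep v p Vt A = if lookup (setOf Vt) p ∧ lookup A p then (A - v) - p else A

-- Whether u survives the round in which the arrival v is matched to its already arrived partner p.
staysAvailable : ∀ {n} → Subset n → Fin n → Fin n → Fin n → Bool
staysAvailable A v p u = if v ≡ᵇ u then not (lookup A p) else (lookup A u ∧ not (p ≡ᵇ u))

module _ {n : ℕ} where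

  lookup-matchStep : ∀ (v p : Fin n) Vt A u → p ∈ᵇ Vt ≡ true → lookup A v ≡ true →
    lookup (matchStep v p Vt A) u ≡ staysAvailable A v p u
  lookup-matchStep v p Vt A u p∈Vt v∈A rewrite p∈Vt with lookup A p in p∈A
  ... | true rewrite lookup-minus (A - v) p u | lookup-minus A v u with v ≟ᶠ u
  ...   | yes refl rewrite ≡ᵇ-refl v | ∧-comm (lookup A v) false = refl
  ...   | no v≢u   rewrite ≢⇒≡ᵇ-false v≢u | ∧-comm (lookup A u) true = refl
  lookup-matchStep v p Vt A u p∈Vt v∈A | false with v ≟ᶠ u
  ...   | yes refl rewrite ≡ᵇ-refl v = v∈A
  ...   | no v≢u   rewrite ≢⇒≡ᵇ-false v≢u with p ≟ᶠ u
  ...     | yes refl rewrite p∈A = refl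
  ...     | no p≢u   rewrite ≢⇒≡ᵇ-false p≢u | ∧-comm (lookup A u) true = refl

  lookup-matchStep-∉ : ∀ (v p : Fin n) Vt A z → z ∈ᵇ Vt ≡ false → v ≡ᵇ z ≡ false →
                       lookup (matchStep v p Vt A) z ≡ lookup A z
  lookup-matchStep-∉ v p Vt A z z∉Vt v≢z with p ∈ᵇ Vt in p∈Vt | lookup A p
  ... | false | _     = refl
  ... | true  | false = refl
  ... | true  | true rewrite lookup-minus (A - v) p z | lookup-minus A v z | v≢z | ∧-identityʳ (lookup A z) with p ≟ᶠ z
  ...   | yes refl = ⊥-elim (case trans (sym p∈Vt) z∉Vt of λ ())
  ...   | no p≢z   rewrite ≢⇒≡ᵇ-false p≢z = ∧-identityʳ (lookup A z)

module _ {n : ℕ} (mm : Subset n → Fin n → Fin n) where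

  round : Maybe (Fin n) → List (Fin n) → ℕ → ℕ → Subset n → Subset n
  round nothing  Vt r t A = A
  round (just v) Vt r t A = matchStep v (mm (setOf (if odd t then removeAt r Vt else Vt)) v) Vt A

  stepVA≡round : ∀ σ τ t A → stepVA mm σ τ t A ≡ round (nth σ (t ∸ 1)) (take t σ) (choice τ (t ∸ 1)) t A
  stepVA≡round σ τ t A with nth σ (t ∸ 1)
  ... | nothing = refl
  ... | just v  = refl

module _ {n : ℕ} (mm : Subset n → Fin n → Fin n) (k : ℕ) where

  available-k : ∀ σ τ → availableAfter mm k σ τ k ≡ ⊤
  available-k σ τ rewrite n∸n≡0 k = refl

  available-suc : ∀ σ τ t → k ≤ t →
    availableAfter mm k σ τ (suc t) ≡ round mm (nth σ t) (take (suc t) σ) (choice τ t) (suc t) (availableAfter mm k σ τ t)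
  available-suc σ τ t k≤t = begin
    foldl step ⊤ (map at (upTo (suc t ∸ k)))
      ≡⟨ cong (λ m → foldl step ⊤ (map at (upTo m))) (+-∸-assoc 1 k≤t) ⟩
    foldl step ⊤ (map at (upTo (suc (t ∸ k))))
      ≡⟨ cong (λ l → foldl step ⊤ (map at l)) (sym (List.upTo-∷ʳ (t ∸ k))) ⟩
    foldl step ⊤ (map at (upTo (t ∸ k) ++ [ t ∸ k ]))
      ≡⟨ cong (foldl step ⊤) (List.map-++ at (upTo (t ∸ k)) [ t ∸ k ]) ⟩
    foldl step ⊤ (map at (upTo (t ∸ k)) ++ [ at (t ∸ k) ])
      ≡⟨ List.foldl-++ step ⊤ (map at (upTo (t ∸ k))) [ at (t ∸ k) ] ⟩
    step (availableAfter mm k σ τ t) (suc (k + (t ∸ k)))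
      ≡⟨ cong (λ m → step (availableAfter mm k σ τ t) (suc m)) (m+[n∸m]≡n k≤t) ⟩
    step (availableAfter mm k σ τ t) (suc t)
      ≡⟨ stepVA≡round mm σ τ (suc t) (availableAfter mm k σ τ t) ⟩
    round mm (nth σ t) (take (suc t) σ) (choice τ t) (suc t) (availableAfter mm k σ τ t) ∎
    where
    step : Subset n → ℕ → Subset n
    step A s = stepVA mm σ τ s A
    at : ℕ → ℕ
    at i = suc (k + i)

  available-prefix : ∀ t → k ≤ t → ∀ σ σ' τ τ' → take t σ ≡ take t σ' → take t τ ≡ take t τ' →
                     availableAfter mm k σ τ t ≡ availableAfter mm k σ' τ' t
  available-prefix = ≤-induction _ k
    (λ σ σ' τ τ' _ _ → trans (available-k σ τ) (sym (available-k σ' τ')))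
    (λ t k≤t ih σ σ' τ τ' σ≈σ' τ≈τ' → begin
      availableAfter mm k σ τ (suc t)
        ≡⟨ available-suc σ τ t k≤t ⟩
      round mm (nth σ t) (take (suc t) σ) (choice τ t) (suc t) (availableAfter mm k σ τ t)
        ≡⟨ cong₂ (λ v r → round mm v (take (suc t) σ) (maybe (λ r → r) 0 r) (suc t) (availableAfter mm k σ τ t))
                 (same-nth σ σ' σ≈σ') (same-nth τ τ' τ≈τ') ⟩
      round mm (nth σ' t) (take (suc t) σ) (choice τ' t) (suc t) (availableAfter mm k σ τ t)
        ≡⟨ cong₂ (λ Vt A → round mm (nth σ' t) Vt (choice τ' t) (suc t) A) σ≈σ'
                 (ih σ σ' τ τ' (shorter σ σ' σ≈σ') (shorter τ τ' τ≈τ')) ⟩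
      round mm (nth σ' t) (take (suc t) σ') (choice τ' t) (suc t) (availableAfter mm k σ' τ' t)
        ≡⟨ sym (available-suc σ' τ' t k≤t) ⟩
      availableAfter mm k σ' τ' (suc t) ∎)
    where
    same-nth : ∀ {t} {A : Set} (l l' : List A) → take (suc t) l ≡ take (suc t) l' → nth l t ≡ nth l' t
    same-nth {t} l l' e = trans (sym (nth-take (suc t) t l ≤-refl)) (trans (cong (λ l → nth l t) e) (nth-take (suc t) t l' ≤-refl))
    shorter : ∀ {t} {A : Set} (l l' : List A) → take (suc t) l ≡ take (suc t) l' → take t l ≡ take t l'
    shorter {t} l l' e = trans (sym (take-take≤ t (suc t) l (n≤1+n t))) (trans (cong (take t) e) (take-take≤ t (suc t) l' (n≤1+n t)))

  available-unarrived : ∀ t → k ≤ t → ∀ σ τ z → z ∈ᵇ take t σ ≡ false → lookup (availableAfter mm k σ τ t) z ≡ true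
  available-unarrived = ≤-induction _ k
    (λ σ τ z _ → trans (cong (λ A → lookup A z) (available-k σ τ)) (lookup-replicate z true))
    (λ t k≤t ih σ τ z z∉ → trans (cong (λ A → lookup A z) (available-suc σ τ t k≤t))
                                 (unarrived-step t ih σ τ z z∉ (nth σ t) refl))
    where
    unarrived-step : ∀ t → (∀ σ τ z → z ∈ᵇ take t σ ≡ false → lookup (availableAfter mm k σ τ t) z ≡ true) →
      ∀ σ τ z → z ∈ᵇ take (suc t) σ ≡ false → ∀ mv → nth σ t ≡ mv →
      lookup (round mm mv (take (suc t) σ) (choice τ t) (suc t) (availableAfter mm k σ τ t)) z ≡ true
    unarrived-step t ih σ τ z z∉ nothing  e = ih σ τ z (trans (cong (z ∈ᵇ_) (sym (take-suc-nothing σ t e))) z∉)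
    unarrived-step t ih σ τ z z∉ (just v) e =
      trans (lookup-matchStep-∉ v _ (take (suc t) σ) _ z z∉ (proj₂ z∉t∷v)) (ih σ τ z (proj₁ z∉t∷v))
      where
      z∉t∷v : (z ∈ᵇ take t σ ≡ false) × (v ≡ᵇ z ≡ false)
      z∉t∷v = ∨≡false _ _ (trans (sym (∈ᵇ-∷ʳ z (take t σ) v)) (trans (cong (z ∈ᵇ_) (sym (take-suc-just σ t e))) z∉))

  available-∷ʳ : ∀ (q : List (Fin n)) y τ → k ≤ length q →
    availableAfter mm k (q ++ [ y ]) τ (suc (length q))
      ≡ round mm (just y) (q ++ [ y ]) (choice τ (length q)) (suc (length q)) (availableAfter mm k q τ (length q))
  available-∷ʳ q y τ k≤q = begin
    availableAfter mm k (q ++ [ y ]) τ (suc (length q))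
      ≡⟨ available-suc (q ++ [ y ]) τ (length q) k≤q ⟩
    round mm (nth (q ++ [ y ]) (length q)) (take (suc (length q)) (q ++ [ y ])) (choice τ (length q)) (suc (length q))
          (availableAfter mm k (q ++ [ y ]) τ (length q))
      ≡⟨ cong₂ (λ v Vt → round mm v Vt (choice τ (length q)) (suc (length q)) (availableAfter mm k (q ++ [ y ]) τ (length q)))
               (nth-∷ʳ q y) (take-suc-length-∷ʳ q y) ⟩
    round mm (just y) (q ++ [ y ]) (choice τ (length q)) (suc (length q)) (availableAfter mm k (q ++ [ y ]) τ (length q))
      ≡⟨ cong (round mm (just y) (q ++ [ y ]) (choice τ (length q)) (suc (length q)))
              (available-prefix (length q) k≤q (q ++ [ y ]) q τ τ
                 (trans (take-length-++ q [ y ]) (sym (List.take-all (length q) q ≤-refl))) refl) ⟩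
    round mm (just y) (q ++ [ y ]) (choice τ (length q)) (suc (length q)) (availableAfter mm k q τ (length q)) ∎

-- Perfect matchings on even sets

Even : ℕ → Set
Even m = m % 2 ≡ 0

odd≡false⇒Even : ∀ t → odd t ≡ false → Even t
odd≡false⇒Even zero          _ = refl
odd≡false⇒Even (suc zero)    ()
odd≡false⇒Even (suc (suc t)) e = odd≡false⇒Even t e

odd-suc⇒Even : ∀ t → odd (suc t) ≡ true → Even t
odd-suc⇒Even zero          _ = refl
odd-suc⇒Even (suc zero)    ()
odd-suc⇒Even (suc (suc t)) e = odd-suc⇒Even t e

Even-minus : ∀ {n} (V : Subset n) (x : Fin n) {t : ℕ} → ∣ V ∣ ≡ suc t → Even t → lookup V x ≡ true → Even ∣ V - x ∣
Even-minus V x ∣V∣≡1+t even x∈V = trans (cong (_% 2) (∣p-x∣≡pred V x ∣V∣≡1+t x∈V)) even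

module _ {n : ℕ} (mm : Subset n → Fin n → Fin n) where

  -- The only consequence of the standing assumption that the counting uses.
  PerfectOnEven : Set
  PerfectOnEven = ∀ W → Even ∣ W ∣ → ∀ v → lookup W v ≡ true →
                  (lookup W (mm W v) ≡ true) × (mm W v ≢ v) × (mm W (mm W v) ≡ v)

  maxMatching⇒PerfectOnEven : (G : WeightedGraph n) → MaxMatchingOracle G mm → PerfectOnEven
  maxMatching⇒PerfectOnEven G oracle W even v v∈W with proj₁ (oracle W even) v (lookup⇒[]= v W v∈W)
  ... | partner∈W , partner≢v , involutive = []=⇒lookup partner∈W , partner≢v , involutive

  avoiding : Subset n → Fin n → ℕ
  avoiding W u = ∑ (allFin n) (λ y → ⟦ lookup W y ⟧ * (⟦ not (y ≡ᵇ u) ⟧ * ⟦ not (mm W y ≡ᵇ u) ⟧))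

  ∑-split-at : (W : Subset n) (u : Fin n) (N K : ℕ) →
    ∑ (allFin n) (λ y → ⟦ lookup W y ⟧ * (⟦ y ≡ᵇ u ⟧ * N + ⟦ not (y ≡ᵇ u) ⟧ * (⟦ not (mm W y ≡ᵇ u) ⟧ * K)))
      ≡ ⟦ lookup W u ⟧ * N + avoiding W u * K
  ∑-split-at W u N K = begin
    ∑ (allFin n) (λ y → ⟦ lookup W y ⟧ * (⟦ y ≡ᵇ u ⟧ * N + ⟦ not (y ≡ᵇ u) ⟧ * (⟦ not (mm W y ≡ᵇ u) ⟧ * K)))
      ≡⟨ ∑-cong (allFin n) (λ y → trans (distribute ⟦ lookup W y ⟧ ⟦ y ≡ᵇ u ⟧ ⟦ not (y ≡ᵇ u) ⟧ ⟦ not (mm W y ≡ᵇ u) ⟧ N K)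
           (cong (λ b → ⟦ b ⟧ * (⟦ lookup W y ⟧ * N) + ⟦ lookup W y ⟧ * (⟦ not (y ≡ᵇ u) ⟧ * ⟦ not (mm W y ≡ᵇ u) ⟧) * K) (≡ᵇ-sym y u))) ⟩
    ∑ (allFin n) (λ y → ⟦ u ≡ᵇ y ⟧ * (⟦ lookup W y ⟧ * N) + ⟦ lookup W y ⟧ * (⟦ not (y ≡ᵇ u) ⟧ * ⟦ not (mm W y ≡ᵇ u) ⟧) * K)
      ≡⟨ ∑-+ (allFin n) _ _ ⟩
    ∑ (allFin n) (λ y → ⟦ u ≡ᵇ y ⟧ * (⟦ lookup W y ⟧ * N)) + ∑ (allFin n) (λ y → ⟦ lookup W y ⟧ * (⟦ not (y ≡ᵇ u) ⟧ * ⟦ not (mm W y ≡ᵇ u) ⟧) * K)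
      ≡⟨ cong₂ _+_ (∑-δ u (λ y → ⟦ lookup W y ⟧ * N)) (∑-*ʳ K (allFin n) _) ⟩
    ⟦ lookup W u ⟧ * N + avoiding W u * K ∎
    where
    distribute : ∀ w e e' c N K → w * (e * N + e' * (c * K)) ≡ e * (w * N) + w * (e' * c) * K
    distribute = solve-∀

module _ {n : ℕ} {mm : Subset n → Fin n → Fin n} (perfect : PerfectOnEven mm) where

  partner-∈-minus : (W : Subset n) (v : Fin n) → Even ∣ W ∣ → lookup W v ≡ true → lookup (W - v) (mm W v) ≡ true
  partner-∈-minus W v even v∈W =
    ∈-minus W v (mm W v) (proj₁ partner) (trans (≡ᵇ-sym v (mm W v)) (≢⇒≡ᵇ-false (proj₁ (proj₂ partner))))
    where
    partner : (lookup W (mm W v) ≡ true) × (mm W v ≢ v) × (mm W (mm W v) ≡ v)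
    partner = perfect W even v v∈W

  partner-∈-minus-discarded : (V : Subset n) (x y : Fin n) {t : ℕ} → ∣ V ∣ ≡ suc t → Even t →
    lookup V y ≡ true → lookup (V - y) x ≡ true → lookup (V - y) (mm (V - x) y) ≡ true
  partner-∈-minus-discarded V x y ∣V∣≡1+t even y∈V x∈V-y =
    ∈-minus V y (mm (V - x) y) (proj₁ (∈-minus⁻ V x _ (proj₁ in-V-x))) (proj₂ in-V-x)
    where
    x∈V : lookup V x ≡ true
    x∈V = proj₁ (∈-minus⁻ V y x x∈V-y)
    y∈V-x : lookup (V - x) y ≡ true
    y∈V-x = ∈-minus V x y y∈V (trans (≡ᵇ-sym x y) (proj₂ (∈-minus⁻ V y x x∈V-y)))
    in-V-x : (lookup (V - x) (mm (V - x) y) ≡ true) × (y ≡ᵇ mm (V - x) y ≡ false)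
    in-V-x = ∈-minus⁻ (V - x) y _ (partner-∈-minus (V - x) y (Even-minus V x ∣V∣≡1+t even x∈V) y∈V-x)

  -- Besides u itself only its partner is lost.
  avoiding-∈ : (W : Subset n) (u : Fin n) → Even ∣ W ∣ → lookup W u ≡ true → 2 + avoiding mm W u ≡ ∣ W ∣
  avoiding-∈ W u even u∈W = sym (begin
    ∣ W ∣
      ≡⟨ ∣p∣≡∑ W ⟩
    ∑ (allFin n) (λ y → ⟦ lookup W y ⟧)
      ≡⟨ ∑-cong (allFin n) split ⟩
    ∑ (allFin n) (λ y → ⟦ u ≡ᵇ y ⟧ + (⟦ mm W u ≡ᵇ y ⟧ + X y))
      ≡⟨ trans (∑-+ (allFin n) _ _) (cong (∑ (allFin n) (λ y → ⟦ u ≡ᵇ y ⟧) +_) (∑-+ (allFin n) _ _)) ⟩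
    ∑ (allFin n) (λ y → ⟦ u ≡ᵇ y ⟧) + (∑ (allFin n) (λ y → ⟦ mm W u ≡ᵇ y ⟧) + avoiding mm W u)
      ≡⟨ cong₂ (λ a b → a + (b + avoiding mm W u)) (∑-δ₁ u) (∑-δ₁ (mm W u)) ⟩
    2 + avoiding mm W u ∎)
    where
    X : Fin n → ℕ
    X y = ⟦ lookup W y ⟧ * (⟦ not (y ≡ᵇ u) ⟧ * ⟦ not (mm W y ≡ᵇ u) ⟧)
    u-partner : (lookup W (mm W u) ≡ true) × (mm W u ≢ u) × (mm W (mm W u) ≡ u)
    u-partner = perfect W even u u∈W
    split : ∀ y → ⟦ lookup W y ⟧ ≡ ⟦ u ≡ᵇ y ⟧ + (⟦ mm W u ≡ᵇ y ⟧ + X y)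
    split y with u ≟ᶠ y
    ... | yes refl rewrite u∈W | ≡ᵇ-refl u | ≢⇒≡ᵇ-false (proj₁ (proj₂ u-partner)) = refl
    ... | no u≢y rewrite ≢⇒≡ᵇ-false u≢y | ≡ᵇ-sym y u | ≢⇒≡ᵇ-false u≢y with mm W u ≟ᶠ y
    ...   | yes refl rewrite proj₁ u-partner | ≡ᵇ-refl (mm W u) | proj₂ (proj₂ u-partner) | ≡ᵇ-refl u = refl
    ...   | no p≢y rewrite ≢⇒≡ᵇ-false p≢y with lookup W y in y∈W
    ...     | false = refl
    ...     | true rewrite ≢⇒≡ᵇ-false (λ yᵖ≡u → p≢y (trans (sym (cong (mm W) yᵖ≡u)) (proj₂ (proj₂ (perfect W even y y∈W))))) = refl

  avoiding-∉ : (W : Subset n) (u : Fin n) → Even ∣ W ∣ → lookup W u ≡ false → avoiding mm W u ≡ ∣ W ∣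
  avoiding-∉ W u even u∉W = trans (∑-cong (allFin n) keep) (sym (∣p∣≡∑ W))
    where
    ≢u : ∀ {z} → lookup W z ≡ true → z ≢ u
    ≢u z∈W refl = case trans (sym z∈W) u∉W of λ ()
    keep : ∀ y → ⟦ lookup W y ⟧ * (⟦ not (y ≡ᵇ u) ⟧ * ⟦ not (mm W y ≡ᵇ u) ⟧) ≡ ⟦ lookup W y ⟧
    keep y with lookup W y in y∈W
    ... | false = refl
    ... | true rewrite ≢⇒≡ᵇ-false (≢u y∈W) | ≢⇒≡ᵇ-false (≢u (proj₁ (perfect W even y y∈W))) = refl

  -- Removing u itself loses nothing, removing any of the t other vertices x loses two in V - x.
  ∑-avoiding-minus : (V : Subset n) (u : Fin n) (t : ℕ) → ∣ V ∣ ≡ suc t → Even t → lookup V u ≡ true →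
                     ∑ (allFin n) (λ x → ⟦ lookup V x ⟧ * avoiding mm (V - x) u) + t ≡ t * t
  ∑-avoiding-minus V u t ∣V∣≡1+t even u∈V = +-cancelʳ-≡ t _ _ (begin
    S + t + t                                                 ≡⟨ +-assoc S t t ⟩
    S + (t + t)                                               ≡⟨ cong (λ m → S + (m + m)) (sym others) ⟩
    S + (∑ (allFin n) c + ∑ (allFin n) c)                     ≡⟨ cong (S +_) (sym (∑-+ (allFin n) c c)) ⟩
    S + ∑ (allFin n) (λ x → c x + c x)                        ≡⟨ sym (∑-+ (allFin n) _ _) ⟩
    ∑ (allFin n) (λ x → ⟦ lookup V x ⟧ * avoiding mm (V - x) u + (c x + c x))
                                                              ≡⟨ ∑-cong (allFin n) each ⟩
    ∑ (allFin n) (λ x → ⟦ lookup V x ⟧ * t)                    ≡⟨ ∑-*ʳ t (allFin n) _ ⟩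
    ∑ (allFin n) (λ x → ⟦ lookup V x ⟧) * t                    ≡⟨ cong (_* t) (trans (sym (∣p∣≡∑ V)) ∣V∣≡1+t) ⟩
    suc t * t                                                 ≡⟨ +-comm t (t * t) ⟩
    t * t + t                                                 ∎)
    where
    S : ℕ
    S = ∑ (allFin n) (λ x → ⟦ lookup V x ⟧ * avoiding mm (V - x) u)
    c : Fin n → ℕ
    c x = ⟦ lookup V x ∧ not (u ≡ᵇ x) ⟧
    others : ∑ (allFin n) c ≡ t
    others = trans (sym (∣p-x∣≡∑ V u)) (∣p-x∣≡pred V u ∣V∣≡1+t u∈V)
    each : ∀ x → ⟦ lookup V x ⟧ * avoiding mm (V - x) u + (c x + c x) ≡ ⟦ lookup V x ⟧ * t
    each x with lookup V x in x∈V
    ... | false = refl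
    ... | true with u ≟ᶠ x
    ...   | yes refl rewrite ≡ᵇ-refl u = trans (+-identityʳ _) (cong (1 *_) (begin
      avoiding mm (V - u) u ≡⟨ avoiding-∉ (V - u) u (Even-minus V u ∣V∣≡1+t even u∈V) (∉-minus V u) ⟩
      ∣ V - u ∣             ≡⟨ ∣p-x∣≡pred V u ∣V∣≡1+t u∈V ⟩
      t                     ∎))
    ...   | no u≢x rewrite ≢⇒≡ᵇ-false u≢x = trans (shift (avoiding mm (V - x) u)) (cong (1 *_) (begin
      2 + avoiding mm (V - x) u ≡⟨ avoiding-∈ (V - x) u (Even-minus V x ∣V∣≡1+t even x∈V) (∈-minus V x u u∈V (trans (≡ᵇ-sym x u) (≢⇒≡ᵇ-false u≢x))) ⟩
      ∣ V - x ∣                 ≡⟨ ∣p-x∣≡pred V x ∣V∣≡1+t x∈V ⟩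
      t                         ∎))
      where
      shift : ∀ a → 1 * a + (1 + 1) ≡ 1 * (2 + a)
      shift = solve-∀

-- Random tapes

-- The choice made in round j + s is uniform over choices k (j + s), independently of the earlier ones.
∑-tapes-choice : ∀ k j s m → j < m → (h : List ℕ → ℕ → ℕ) →
  length (choices k (j + s)) * ∑ (tapesFrom k s m) (λ τ → h (take j τ) (choice τ j))
    ≡ ∑ (tapesFrom k s m) (λ τ → ∑ (choices k (j + s)) (h (take j τ)))
∑-tapes-choice k zero s (suc m) _ h = begin
  c * ∑ (concatMap (λ r → map (r ∷_) later) (choices k s)) (λ τ → h [] (choice τ 0))
    ≡⟨ cong (c *_) (trans (∑-concatMap _ (choices k s) _)
                          (∑-cong (choices k s) (λ r → trans (∑-map (r ∷_) later _) (∑-const later (h [] r))))) ⟩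
  c * ∑ (choices k s) (λ r → length later * h [] r)
    ≡⟨ cong (c *_) (∑-*ˡ (length later) (choices k s) (h [])) ⟩
  c * (length later * ∑ (choices k s) (h []))
    ≡⟨ sym (∑-const (choices k s) _) ⟩
  ∑ (choices k s) (λ _ → length later * ∑ (choices k s) (h []))
    ≡⟨ sym (trans (∑-concatMap _ (choices k s) _)
                  (∑-cong (choices k s) (λ r → trans (∑-map (r ∷_) later _) (∑-const later _)))) ⟩
  ∑ (concatMap (λ r → map (r ∷_) later) (choices k s)) (λ τ → ∑ (choices k s) (h [])) ∎
  where
  later : List (List ℕ)
  later = tapesFrom k (suc s) m
  c : ℕ
  c = length (choices k s)
∑-tapes-choice k (suc j) s (suc m) (s≤s j<m) h = begin
  c * ∑ (concatMap (λ r → map (r ∷_) later) (choices k s)) (λ τ → h (take (suc j) τ) (choice τ (suc j)))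
    ≡⟨ cong (c *_) (trans (∑-concatMap _ (choices k s) _) (∑-cong (choices k s) (λ r → ∑-map (r ∷_) later _))) ⟩
  c * ∑ (choices k s) (λ r → ∑ later (λ τ → h (r ∷ take j τ) (choice τ j)))
    ≡⟨ sym (∑-*ˡ c (choices k s) _) ⟩
  ∑ (choices k s) (λ r → c * ∑ later (λ τ → h (r ∷ take j τ) (choice τ j)))
    ≡⟨ ∑-cong (choices k s) (λ r → subst
         (λ w → length (choices k w) * ∑ later (λ τ → h (r ∷ take j τ) (choice τ j)) ≡ ∑ later (λ τ → ∑ (choices k w) (h (r ∷ take j τ))))
         (+-suc j s) (∑-tapes-choice k j (suc s) m j<m (λ τ₀ → h (r ∷ τ₀)))) ⟩
  ∑ (choices k s) (λ r → ∑ later (λ τ → ∑ (choices k (suc j + s)) (h (r ∷ take j τ))))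
    ≡⟨ sym (trans (∑-concatMap _ (choices k s) _) (∑-cong (choices k s) (λ r → ∑-map (r ∷_) later _))) ⟩
  ∑ (concatMap (λ r → map (r ∷_) later) (choices k s)) (λ τ → ∑ (choices k (suc j + s)) (h (take (suc j) τ))) ∎
  where
  later : List (List ℕ)
  later = tapesFrom k (suc s) m
  c : ℕ
  c = length (choices k (suc j + s))

choices-odd : ∀ k t → k ≤ t → odd (suc t) ≡ true → choices k (t + 1) ≡ upTo t
choices-odd k t k≤t odd-1+t = trans (cong (choices k) (+-comm t 1))
  (cong₂ (λ a b → if a ∧ b then upTo t else (0 ∷ [])) odd-1+t (T⇒≡true (<⇒<ᵇ (s≤s k≤t))))
  where
  T⇒≡true : ∀ {b} → T b → b ≡ true
  T⇒≡true {true} _ = refl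

choices-nonempty : ∀ k t → 1 ≤ k → 1 ≤ length (choices k t)
choices-nonempty k t 1≤k with odd t ∧ (k <ᵇ t) in e
... | false = s≤s z≤n
... | true rewrite List.length-upTo (t ∸ 1) =
  ≤-trans 1≤k (≤-pred-∸ (<ᵇ⇒< k t (subst T (sym (proj₂ (∧≡true (odd t) (k <ᵇ t) e))) tt)))
  where
  ≤-pred-∸ : ∀ {a b} → a < b → a ≤ b ∸ 1
  ≤-pred-∸ {b = suc b} (s≤s a≤b) = a≤b

tapes-nonempty : ∀ k s m → 1 ≤ k → 1 ≤ length (tapesFrom k s m)
tapes-nonempty k s zero    _   = s≤s z≤n
tapes-nonempty k s (suc m) 1≤k = extend (choices k s) (choices-nonempty k s 1≤k)
  where
  later : List (List ℕ)
  later = tapesFrom k (suc s) m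
  extend : ∀ cs → 1 ≤ length cs → 1 ≤ length (concatMap (λ r → map (r ∷_) later) cs)
  extend (r ∷ cs) _ = ≤-trans (tapes-nonempty k (suc s) m 1≤k) (≤-trans (≤-reflexive (sym (List.length-map (r ∷_) later)))
    (≤-trans (m≤m+n _ _) (≤-reflexive (sym (List.length-++ (map (r ∷_) later))))))

∑-applyUpTo : (g : ℕ → ℕ) (m : ℕ) (F : ℕ → ℕ) → ∑ (applyUpTo g m) F ≡ ∑ (upTo m) (λ i → F (g i))
∑-applyUpTo g zero    F = refl
∑-applyUpTo g (suc m) F = cong (F (g 0) +_)
  (trans (∑-applyUpTo (λ i → g (suc i)) m F) (sym (∑-applyUpTo suc m (λ i → F (g i)))))

∑-upTo-cong : (m : ℕ) {F G : ℕ → ℕ} → (∀ r → r < m → F r ≡ G r) → ∑ (upTo m) F ≡ ∑ (upTo m) G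
∑-upTo-cong zero    e = refl
∑-upTo-cong (suc m) {F} {G} e = cong₂ _+_ (e 0 (s≤s z≤n)) (begin
  ∑ (applyUpTo suc m) F         ≡⟨ ∑-applyUpTo suc m F ⟩
  ∑ (upTo m) (λ i → F (suc i))  ≡⟨ ∑-upTo-cong m (λ r r<m → e (suc r) (s≤s r<m)) ⟩
  ∑ (upTo m) (λ i → G (suc i))  ≡⟨ sym (∑-applyUpTo suc m G) ⟩
  ∑ (applyUpTo suc m) G         ∎)

∑-upTo-nth : ∀ {n} (q : List (Fin n)) → Distinct q → (f : Maybe (Fin n) → ℕ) →
             ∑ (upTo (length q)) (λ r → f (nth q r)) ≡ ∑ (allFin n) (λ x → ⟦ x ∈ᵇ q ⟧ * f (just x))
∑-upTo-nth {n} []      _ f = sym (trans (∑-cong (allFin n) (λ x → cong (λ b → ⟦ b ⟧ * f (just x)) (∈ᵇ-[] x))) (∑-zero (allFin n)))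
∑-upTo-nth {n} (w ∷ q) (w∉q , d) f = begin
  f (just w) + ∑ (applyUpTo suc (length q)) (λ r → f (nth (w ∷ q) r))
    ≡⟨ cong₂ _+_ (sym (∑-δ w (λ x → f (just x)))) (trans (∑-applyUpTo suc (length q) _) (∑-upTo-nth q d f)) ⟩
  ∑ (allFin n) (λ x → ⟦ w ≡ᵇ x ⟧ * f (just x)) + ∑ (allFin n) (λ x → ⟦ x ∈ᵇ q ⟧ * f (just x))
    ≡⟨ sym (∑-+ (allFin n) _ _) ⟩
  ∑ (allFin n) (λ x → ⟦ w ≡ᵇ x ⟧ * f (just x) + ⟦ x ∈ᵇ q ⟧ * f (just x))
    ≡⟨ ∑-cong (allFin n) merge ⟩
  ∑ (allFin n) (λ x → ⟦ x ∈ᵇ (w ∷ q) ⟧ * f (just x)) ∎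
  where
  merge : ∀ x → ⟦ w ≡ᵇ x ⟧ * f (just x) + ⟦ x ∈ᵇ q ⟧ * f (just x) ≡ ⟦ x ∈ᵇ (w ∷ q) ⟧ * f (just x)
  merge x rewrite ∈ᵇ-∷ x w q with w ≟ᶠ x
  ... | yes refl rewrite ≡ᵇ-refl w | w∉q = +-identityʳ _
  ... | no w≢x   rewrite ≢⇒≡ᵇ-false w≢x = refl

-- One round

nth-<-length : ∀ {A : Set} r (q : List A) → r < length q → Σ[ x ∈ A ] nth q r ≡ just x
nth-<-length zero    (x ∷ q) _        = x , refl
nth-<-length (suc r) (x ∷ q) (s≤s lt) = nth-<-length r q lt

module _ {n : ℕ} where

  ∈ᵇ-nth : ∀ r (q : List (Fin n)) {x} → nth q r ≡ just x → x ∈ᵇ q ≡ true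
  ∈ᵇ-nth zero    (w ∷ q)     refl rewrite ∈ᵇ-∷ w w q | ≡ᵇ-refl w = refl
  ∈ᵇ-nth (suc r) (w ∷ q) {x} e    rewrite ∈ᵇ-∷ x w q | ∈ᵇ-nth r q e = ∨-zeroʳ (w ≡ᵇ x)

  removeAt-∷ʳ : ∀ r (q : List (Fin n)) y → r < length q → removeAt r (q ++ [ y ]) ≡ removeAt r q ++ [ y ]
  removeAt-∷ʳ zero    (x ∷ q) y _        = refl
  removeAt-∷ʳ (suc r) (x ∷ q) y (s≤s lt) = cong (x ∷_) (removeAt-∷ʳ r q y lt)

  ∈ᵇ-removeAt : ∀ r (q : List (Fin n)) x → Distinct q → nth q r ≡ just x → ∀ z → z ∈ᵇ removeAt r q ≡ z ∈ᵇ q ∧ not (x ≡ᵇ z)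
  ∈ᵇ-removeAt zero (w ∷ q) .w (w∉q , _) refl z rewrite ∈ᵇ-∷ z w q with w ≟ᶠ z
  ... | yes refl rewrite w∉q | ≡ᵇ-refl w = refl
  ... | no w≢z   rewrite ≢⇒≡ᵇ-false w≢z | ∧-identityʳ (z ∈ᵇ q) = refl
  ∈ᵇ-removeAt (suc r) (w ∷ q) x (w∉q , d) e z
    rewrite ∈ᵇ-∷ z w (removeAt r q) | ∈ᵇ-∷ z w q | ∈ᵇ-removeAt r q x d e z with w ≟ᶠ z
  ... | no w≢z   rewrite ≢⇒≡ᵇ-false w≢z = refl
  ... | yes refl with x ≟ᶠ w
  ...   | no x≢w rewrite ≢⇒≡ᵇ-false x≢w | ≡ᵇ-refl w = refl
  ...   | yes refl = ⊥-elim (case trans (sym (∈ᵇ-nth r q e)) w∉q of λ ())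

  setOf-removeAt-∷ʳ : ∀ (q : List (Fin n)) y V r x → Distinct q → setOf q ≡ V - y → lookup V y ≡ true →
                      r < length q → nth q r ≡ just x → setOf (removeAt r (q ++ [ y ])) ≡ V - x
  setOf-removeAt-∷ʳ q y V r x d q≡V-y y∈V r<q qᵣ≡x = Subset-ext _ _ same
    where
    ∈q : ∀ z → z ∈ᵇ q ≡ lookup V z ∧ not (y ≡ᵇ z)
    ∈q z = trans (cong (λ S → lookup S z) q≡V-y) (lookup-minus V y z)
    x≢y : x ≡ᵇ y ≡ false
    x≢y with x ≟ᶠ y
    ... | no x≢y   = ≢⇒≡ᵇ-false x≢y
    ... | yes refl = ⊥-elim (case trans (sym (∈ᵇ-nth r q qᵣ≡x)) (trans (cong (λ S → lookup S x) q≡V-y) (∉-minus V x)) of λ ())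
    same : ∀ z → z ∈ᵇ removeAt r (q ++ [ y ]) ≡ lookup (V - x) z
    same z rewrite removeAt-∷ʳ r q y r<q | ∈ᵇ-∷ʳ z (removeAt r q) y | ∈ᵇ-removeAt r q x d qᵣ≡x z | ∈q z
                 | lookup-minus V x z with y ≟ᶠ z
    ... | yes refl rewrite ≡ᵇ-refl y | x≢y | y∈V = refl
    ... | no y≢z   rewrite ≢⇒≡ᵇ-false y≢z = trans (∨-identityʳ _) (cong (_∧ not (x ≡ᵇ z)) (∧-identityʳ (lookup V z)))

  ∑-discarded : ∀ (q : List (Fin n)) y V → Distinct q → setOf q ≡ V - y → lookup V y ≡ true → (G : Subset n → ℕ) →
    ∑ (upTo (length q)) (λ r → G (setOf (removeAt r (q ++ [ y ])))) ≡ ∑ (allFin n) (λ x → ⟦ lookup (V - y) x ⟧ * G (V - x))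
  ∑-discarded q y V d q≡V-y y∈V G = begin
    ∑ (upTo (length q)) (λ r → G (setOf (removeAt r (q ++ [ y ]))))
      ≡⟨ ∑-upTo-cong (length q) position ⟩
    ∑ (upTo (length q)) (λ r → f (nth q r))
      ≡⟨ ∑-upTo-nth q d f ⟩
    ∑ (allFin n) (λ x → ⟦ x ∈ᵇ q ⟧ * G (V - x))
      ≡⟨ ∑-cong (allFin n) (λ x → cong (λ S → ⟦ lookup S x ⟧ * G (V - x)) q≡V-y) ⟩
    ∑ (allFin n) (λ x → ⟦ lookup (V - y) x ⟧ * G (V - x)) ∎
    where
    f : Maybe (Fin n) → ℕ
    f nothing  = 0
    f (just x) = G (V - x)
    position : ∀ r → r < length q → G (setOf (removeAt r (q ++ [ y ]))) ≡ f (nth q r)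
    position r r<q with nth-<-length r q r<q
    ... | x , qᵣ≡x rewrite qᵣ≡x = cong G (setOf-removeAt-∷ʳ q y V r x d q≡V-y y∈V r<q qᵣ≡x)

module _ {n : ℕ} {mm : Subset n → Fin n → Fin n} (perfect : PerfectOnEven mm) (k : ℕ) where

  arrival-available : ∀ (q : List (Fin n)) y V τ t → length q ≡ t → k ≤ t → setOf q ≡ V - y →
                      lookup (availableAfter mm k q τ t) y ≡ true
  arrival-available q y V τ .(length q) refl k≤t q≡V-y = available-unarrived mm k (length q) k≤t q τ y
    (trans (cong (y ∈ᵇ_) (List.take-all (length q) q ≤-refl)) (trans (cong (λ S → lookup S y) q≡V-y) (∉-minus V y)))

  available-∷ʳ-even : ∀ (q : List (Fin n)) y V u τ t → length q ≡ t → k ≤ t → setOf q ≡ V - y → lookup V y ≡ true →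
    ∣ V ∣ ≡ suc t → odd (suc t) ≡ false →
    lookup (availableAfter mm k (q ++ [ y ]) τ (suc t)) u ≡ staysAvailable (availableAfter mm k q τ t) y (mm V y) u
  available-∷ʳ-even q y V u τ .(length q) refl k≤t q≡V-y y∈V ∣V∣≡1+t even-round = begin
    lookup (availableAfter mm k (q ++ [ y ]) τ (suc (length q))) u
      ≡⟨ cong (λ B → lookup B u) (available-∷ʳ mm k q y τ k≤t) ⟩
    lookup (matchStep y (mm (setOf (if odd (suc (length q)) then removeAt r (q ++ [ y ]) else q ++ [ y ])) y) (q ++ [ y ]) A) u
      ≡⟨ cong (λ b → lookup (matchStep y (mm (setOf (if b then removeAt r (q ++ [ y ]) else q ++ [ y ])) y) (q ++ [ y ]) A) u)
              even-round ⟩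
    lookup (matchStep y (mm (setOf (q ++ [ y ])) y) (q ++ [ y ]) A) u
      ≡⟨ cong (λ S → lookup (matchStep y (mm S y) (q ++ [ y ]) A) u) q∷y≡V ⟩
    lookup (matchStep y (mm V y) (q ++ [ y ]) A) u
      ≡⟨ lookup-matchStep y (mm V y) (q ++ [ y ]) A u partner-arrived (arrival-available q y V τ (length q) refl k≤t q≡V-y) ⟩
    staysAvailable A y (mm V y) u ∎
    where
    A : Subset n
    A = availableAfter mm k q τ (length q)
    r : ℕ
    r = choice τ (length q)
    q∷y≡V : setOf (q ++ [ y ]) ≡ V
    q∷y≡V = setOf-∷ʳ q y V y∈V q≡V-y
    partner-arrived : mm V y ∈ᵇ (q ++ [ y ]) ≡ true
    partner-arrived = trans (cong (λ S → lookup S (mm V y)) q∷y≡V)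
      (proj₁ (perfect V (trans (cong (_% 2) ∣V∣≡1+t) (odd≡false⇒Even (suc (length q)) even-round)) y y∈V))

  -- The discarded vertex v_r is uniform over the t earlier arrivals, i.e. over V - y.
  available-∷ʳ-odd : ∀ (q : List (Fin n)) y V u t → length q ≡ t → k ≤ t → t < n → Distinct q →
    setOf q ≡ V - y → lookup V y ≡ true → ∣ V ∣ ≡ suc t → odd (suc t) ≡ true →
    t * ∑ (allTapes n k) (λ τ → ⟦ lookup (availableAfter mm k (q ++ [ y ]) τ (suc t)) u ⟧)
      ≡ ∑ (allTapes n k) (λ τ → ∑ (allFin n) (λ x → ⟦ lookup (V - y) x ⟧ * ⟦ staysAvailable (availableAfter mm k q τ t) y (mm (V - x) y) u ⟧))
  available-∷ʳ-odd q y V u .(length q) refl k≤t t<n d q≡V-y y∈V ∣V∣≡1+t odd-round = begin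
    t * ∑ tapes (λ τ → ⟦ lookup (availableAfter mm k (q ++ [ y ]) τ (suc t)) u ⟧)
      ≡⟨ cong₂ _*_ (sym (trans (cong length (choices-odd k t k≤t odd-round)) (List.length-upTo t)))
                   (∑-cong tapes (λ τ → cong (λ B → ⟦ lookup B u ⟧) (trans (available-∷ʳ mm k q y τ k≤t) (discard τ)))) ⟩
    length (choices k (t + 1)) * ∑ tapes (λ τ → h (take t τ) (choice τ t))
      ≡⟨ ∑-tapes-choice k t 1 n t<n h ⟩
    ∑ tapes (λ τ → ∑ (choices k (t + 1)) (h (take t τ)))
      ≡⟨ ∑-cong tapes (λ τ → cong₂ (λ l B → ∑ l (λ r → survives B (setOf (removeAt r (q ++ [ y ])))))
                                   (choices-odd k t k≤t odd-round) (prefix τ)) ⟩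
    ∑ tapes (λ τ → ∑ (upTo t) (λ r → survives (A τ) (setOf (removeAt r (q ++ [ y ])))))
      ≡⟨ ∑-cong tapes (λ τ → ∑-discarded q y V d q≡V-y y∈V (survives (A τ))) ⟩
    ∑ tapes (λ τ → ∑ (allFin n) (λ x → ⟦ lookup (V - y) x ⟧ * survives (A τ) (V - x)))
      ≡⟨ ∑-cong tapes (λ τ → ∑-cong (allFin n) (λ x → ⟦⟧*-cong (lookup (V - y) x) (λ x∈V-y → cong ⟦_⟧
           (lookup-matchStep y (mm (V - x) y) (q ++ [ y ]) (A τ) u (partner-arrived x x∈V-y)
                             (arrival-available q y V τ t refl k≤t q≡V-y))))) ⟩
    ∑ tapes (λ τ → ∑ (allFin n) (λ x → ⟦ lookup (V - y) x ⟧ * ⟦ staysAvailable (A τ) y (mm (V - x) y) u ⟧)) ∎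
    where
    t : ℕ
    t = length q
    tapes : List (List ℕ)
    tapes = allTapes n k
    A : List ℕ → Subset n
    A τ = availableAfter mm k q τ t
    survives : Subset n → Subset n → ℕ
    survives B S = ⟦ lookup (matchStep y (mm S y) (q ++ [ y ]) B) u ⟧
    h : List ℕ → ℕ → ℕ
    h τ r = survives (A τ) (setOf (removeAt r (q ++ [ y ])))
    prefix : ∀ τ → A (take t τ) ≡ A τ
    prefix τ = available-prefix mm k t k≤t q q (take t τ) τ refl (take-take≤ t t τ ≤-refl)
    discard : ∀ τ → round mm (just y) (q ++ [ y ]) (choice τ t) (suc t) (A τ)
                    ≡ matchStep y (mm (setOf (removeAt (choice τ t) (q ++ [ y ]))) y) (q ++ [ y ]) (A (take t τ))
    discard τ = cong₂ (λ b B → matchStep y (mm (setOf (if b then removeAt (choice τ t) (q ++ [ y ]) else q ++ [ y ])) y) (q ++ [ y ]) B)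
                      odd-round (sym (prefix τ))
    partner-arrived : ∀ x → lookup (V - y) x ≡ true → mm (V - x) y ∈ᵇ (q ++ [ y ]) ≡ true
    partner-arrived x x∈V-y = trans (cong (λ S → lookup S (mm (V - x) y)) (setOf-∷ʳ q y V y∈V q≡V-y))
      (proj₁ (∈-minus⁻ V y _ (partner-∈-minus-discarded perfect V x y ∣V∣≡1+t (odd-suc⇒Even t odd-round) y∈V x∈V-y)))

-- The recurrence

module Counting {n : ℕ} (mm : Subset n → Fin n → Fin n) (k : ℕ) where

  tapes : List (List ℕ)
  tapes = allTapes n k

  availCount : ℕ → Subset n → Fin n → ℕ
  availCount t V u = ∑ (arrangements t (allFin n))
    (λ p → ⟦ sameSet (setOf p) V ⟧ * ∑ tapes (λ τ → ⟦ lookup (availableAfter mm k p τ t) u ⟧))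

  matchedCount : ℕ → Subset n → Fin n → ℕ
  matchedCount t V u = ∑ (arrangements t (allFin n))
    (λ p → ⟦ sameSet (setOf p) V ⟧ * ∑ tapes (λ τ → ⟦ not (lookup (availableAfter mm k p τ t) u) ⟧))

  availCount+matchedCount : ∀ t V u → ∣ V ∣ ≡ t → availCount t V u + matchedCount t V u ≡ t ! * length tapes
  availCount+matchedCount t V u ∣V∣≡t = begin
    availCount t V u + matchedCount t V u
      ≡⟨ sym (∑-+ (arrangements t (allFin n)) _ _) ⟩
    ∑ (arrangements t (allFin n)) (λ p → ⟦ sameSet (setOf p) V ⟧ * ∑ tapes (λ τ → ⟦ a p τ ⟧)
                                       + ⟦ sameSet (setOf p) V ⟧ * ∑ tapes (λ τ → ⟦ not (a p τ) ⟧))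
      ≡⟨ ∑-cong (arrangements t (allFin n)) (λ p → trans (sym (*-distribˡ-+ ⟦ sameSet (setOf p) V ⟧ _ _))
           (cong (⟦ sameSet (setOf p) V ⟧ *_) (trans (sym (∑-+ tapes _ _))
             (trans (∑-cong tapes (λ τ → ⟦⟧+⟦not⟧ (a p τ))) (∑-const tapes 1))))) ⟩
    ∑ (arrangements t (allFin n)) (λ p → ⟦ sameSet (setOf p) V ⟧ * (length tapes * 1))
      ≡⟨ ∑-*ʳ (length tapes * 1) (arrangements t (allFin n)) _ ⟩
    ∑ (arrangements t (allFin n)) (λ p → ⟦ sameSet (setOf p) V ⟧) * (length tapes * 1)
      ≡⟨ cong₂ _*_ (∑-arrangements-sameSet t V ∣V∣≡t) (*-identityʳ (length tapes)) ⟩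
    t ! * length tapes ∎
    where
    a : List (Fin n) → List ℕ → Bool
    a p τ = lookup (availableAfter mm k p τ t) u

  Uniform : ℕ → ℕ → ℕ → Set
  Uniform t K N = ∀ V u → ∣ V ∣ ≡ t → lookup V u ≡ true → (availCount t V u ≡ K) × (matchedCount t V u ≡ N)

  module Step (perfect : PerfectOnEven mm) (t : ℕ) (k≤t : k ≤ t) (t<n : t < n) (K N : ℕ) (uniform : Uniform t K N)
              (V : Subset n) (u : Fin n) (∣V∣≡1+t : ∣ V ∣ ≡ suc t) (u∈V : lookup V u ≡ true) where

    lastArrival : Fin n → ℕ
    lastArrival y = ∑ (arrangements t (allFin n))
      (λ q → ⟦ sameSet (setOf q) (V - y) ⟧ * ∑ tapes (λ τ → ⟦ lookup (availableAfter mm k (q ++ [ y ]) τ (suc t)) u ⟧))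

    availCount-last : availCount (suc t) V u ≡ ∑ (allFin n) (λ y → ⟦ lookup V y ⟧ * lastArrival y)
    availCount-last = ∑-arrangements-last V t _

    ∑-staysAvailable : ∀ y p → lookup V y ≡ true → lookup (V - y) p ≡ true →
      ∑ (arrangements t (allFin n))
        (λ q → ⟦ sameSet (setOf q) (V - y) ⟧ * ∑ tapes (λ τ → ⟦ staysAvailable (availableAfter mm k q τ t) y p u ⟧))
        ≡ ⟦ y ≡ᵇ u ⟧ * N + ⟦ not (y ≡ᵇ u) ⟧ * (⟦ not (p ≡ᵇ u) ⟧ * K)
    ∑-staysAvailable y p y∈V p∈V-y with y ≟ᶠ u
    ... | yes refl rewrite ≡ᵇ-refl y = begin
      matchedCount t (V - y) p ≡⟨ proj₂ (uniform (V - y) p ∣V-y∣ p∈V-y) ⟩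
      N                        ≡⟨ sym (trans (+-identityʳ (N + 0)) (+-identityʳ N)) ⟩
      N + 0 + 0                ∎
      where
      ∣V-y∣ : ∣ V - y ∣ ≡ t
      ∣V-y∣ = ∣p-x∣≡pred V y ∣V∣≡1+t y∈V
    ... | no y≢u rewrite ≢⇒≡ᵇ-false y≢u = begin
      ∑ Q (λ q → s q * ∑ tapes (λ τ → ⟦ lookup (A q τ) u ∧ not (p ≡ᵇ u) ⟧))
        ≡⟨ ∑-cong Q (λ q → cong (s q *_) (trans (∑-cong tapes (λ τ → ⟦∧⟧ (lookup (A q τ) u) _)) (∑-*ʳ c tapes _))) ⟩
      ∑ Q (λ q → s q * (∑ tapes (λ τ → ⟦ lookup (A q τ) u ⟧) * c))
        ≡⟨ trans (∑-cong Q (λ q → sym (*-assoc (s q) _ c))) (∑-*ʳ c Q _) ⟩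
      availCount t (V - y) u * c
        ≡⟨ cong (_* c) (proj₁ (uniform (V - y) u (∣p-x∣≡pred V y ∣V∣≡1+t y∈V) u∈V-y)) ⟩
      K * c
        ≡⟨ trans (*-comm K c) (sym (+-identityʳ (c * K))) ⟩
      c * K + 0 ∎
      where
      Q : List (List (Fin n))
      Q = arrangements t (allFin n)
      s : List (Fin n) → ℕ
      s q = ⟦ sameSet (setOf q) (V - y) ⟧
      A : List (Fin n) → List ℕ → Subset n
      A q τ = availableAfter mm k q τ t
      c : ℕ
      c = ⟦ not (p ≡ᵇ u) ⟧
      u∈V-y : lookup (V - y) u ≡ true
      u∈V-y = ∈-minus V y u u∈V (≢⇒≡ᵇ-false y≢u)

    lastArrival-even : odd (suc t) ≡ false → ∀ y → lookup V y ≡ true →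
                       lastArrival y ≡ ⟦ y ≡ᵇ u ⟧ * N + ⟦ not (y ≡ᵇ u) ⟧ * (⟦ not (mm V y ≡ᵇ u) ⟧ * K)
    lastArrival-even even-round y y∈V = trans
      (∑-arrangements-sameSet-cong t (V - y) (λ q ∣q∣≡t _ q≡V-y → ∑-cong tapes (λ τ → cong ⟦_⟧
        (available-∷ʳ-even perfect k q y V u τ t ∣q∣≡t k≤t q≡V-y y∈V ∣V∣≡1+t even-round))))
      (∑-staysAvailable y (mm V y) y∈V
        (partner-∈-minus perfect V y (trans (cong (_% 2) ∣V∣≡1+t) (odd≡false⇒Even (suc t) even-round)) y∈V))

    lastArrival-odd : odd (suc t) ≡ true → ∀ y → lookup V y ≡ true →
      t * lastArrival y
        ≡ ∑ (allFin n) (λ x → ⟦ lookup (V - y) x ⟧ * (⟦ y ≡ᵇ u ⟧ * N + ⟦ not (y ≡ᵇ u) ⟧ * (⟦ not (mm (V - x) y ≡ᵇ u) ⟧ * K)))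
    lastArrival-odd odd-round y y∈V = begin
      t * ∑ Q (λ q → s q * ∑ tapes (λ τ → ⟦ lookup (availableAfter mm k (q ++ [ y ]) τ (suc t)) u ⟧))
        ≡⟨ trans (sym (∑-*ˡ t Q _)) (∑-cong Q (λ q → exchange t (s q) _)) ⟩
      ∑ Q (λ q → s q * (t * ∑ tapes (λ τ → ⟦ lookup (availableAfter mm k (q ++ [ y ]) τ (suc t)) u ⟧)))
        ≡⟨ ∑-arrangements-sameSet-cong t (V - y) (λ q ∣q∣≡t dq q≡V-y →
             available-∷ʳ-odd perfect k q y V u t ∣q∣≡t k≤t t<n dq q≡V-y y∈V ∣V∣≡1+t odd-round) ⟩
      ∑ Q (λ q → s q * ∑ tapes (λ τ → ∑ (allFin n) (λ x → ⟦ lookup (V - y) x ⟧ * ⟦ stays q τ x ⟧)))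
        ≡⟨ ∑-swap-weighted Q tapes (allFin n) s (λ x → ⟦ lookup (V - y) x ⟧) (λ q τ x → ⟦ stays q τ x ⟧) ⟩
      ∑ (allFin n) (λ x → ⟦ lookup (V - y) x ⟧ * ∑ Q (λ q → s q * ∑ tapes (λ τ → ⟦ stays q τ x ⟧)))
        ≡⟨ ∑-cong (allFin n) (λ x → ⟦⟧*-cong (lookup (V - y) x) (λ x∈V-y →
             ∑-staysAvailable y (mm (V - x) y) y∈V
               (partner-∈-minus-discarded perfect V x y ∣V∣≡1+t (odd-suc⇒Even t odd-round) y∈V x∈V-y))) ⟩
      ∑ (allFin n) (λ x → ⟦ lookup (V - y) x ⟧ * (⟦ y ≡ᵇ u ⟧ * N + ⟦ not (y ≡ᵇ u) ⟧ * (⟦ not (mm (V - x) y ≡ᵇ u) ⟧ * K))) ∎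
      where
      Q : List (List (Fin n))
      Q = arrangements t (allFin n)
      s : List (Fin n) → ℕ
      s q = ⟦ sameSet (setOf q) (V - y) ⟧
      stays : List (Fin n) → List ℕ → Fin n → Bool
      stays q τ x = staysAvailable (availableAfter mm k q τ t) y (mm (V - x) y) u
      exchange : ∀ a b c → a * (b * c) ≡ b * (a * c)
      exchange = solve-∀

    availCount-even : odd (suc t) ≡ false → availCount (suc t) V u + K ≡ N + t * K
    availCount-even even-round = begin
      availCount (suc t) V u + K
        ≡⟨ cong (_+ K) (trans availCount-last (∑-cong (allFin n) (λ y →
             ⟦⟧*-cong (lookup V y) (lastArrival-even even-round y)))) ⟩
      ∑ (allFin n) (λ y → ⟦ lookup V y ⟧ * (⟦ y ≡ᵇ u ⟧ * N + ⟦ not (y ≡ᵇ u) ⟧ * (⟦ not (mm V y ≡ᵇ u) ⟧ * K))) + K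
        ≡⟨ cong (_+ K) (∑-split-at mm V u N K) ⟩
      ⟦ lookup V u ⟧ * N + avoiding mm V u * K + K
        ≡⟨ cong (λ b → ⟦ b ⟧ * N + avoiding mm V u * K + K) u∈V ⟩
      1 * N + avoiding mm V u * K + K
        ≡⟨ collect N (avoiding mm V u) K ⟩
      N + suc (avoiding mm V u) * K
        ≡⟨ cong (λ m → N + m * K) (suc-injective (trans (avoiding-∈ perfect V u even u∈V) ∣V∣≡1+t)) ⟩
      N + t * K ∎
      where
      even : Even ∣ V ∣
      even = trans (cong (_% 2) ∣V∣≡1+t) (odd≡false⇒Even (suc t) even-round)
      collect : ∀ N a K → 1 * N + a * K + K ≡ N + suc a * K
      collect = solve-∀

    t*availCount-odd : odd (suc t) ≡ true →
      t * availCount (suc t) V u ≡ t * N + ∑ (allFin n) (λ x → ⟦ lookup V x ⟧ * avoiding mm (V - x) u) * K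
    t*availCount-odd odd-round = begin
      t * availCount (suc t) V u
        ≡⟨ trans (cong (t *_) availCount-last) (sym (∑-*ˡ t (allFin n) _)) ⟩
      ∑ (allFin n) (λ y → t * (⟦ lookup V y ⟧ * lastArrival y))
        ≡⟨ ∑-cong (allFin n) (λ y → trans (exchange t ⟦ lookup V y ⟧ _) (⟦⟧*-cong (lookup V y) (lastArrival-odd odd-round y))) ⟩
      ∑ (allFin n) (λ y → ⟦ lookup V y ⟧ * ∑ (allFin n) (λ x → ⟦ lookup (V - y) x ⟧ * g y x))
        ≡⟨ ∑-cong (allFin n) (λ y → trans (sym (∑-*ˡ ⟦ lookup V y ⟧ (allFin n) _))
                                          (∑-cong (allFin n) (λ x → sym (*-assoc ⟦ lookup V y ⟧ _ _)))) ⟩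
      ∑ (allFin n) (λ y → ∑ (allFin n) (λ x → ⟦ lookup V y ⟧ * ⟦ lookup (V - y) x ⟧ * g y x))
        ≡⟨ ∑-swap (allFin n) (allFin n) _ ⟩
      ∑ (allFin n) (λ x → ∑ (allFin n) (λ y → ⟦ lookup V y ⟧ * ⟦ lookup (V - y) x ⟧ * g y x))
        ≡⟨ ∑-cong (allFin n) (λ x → trans (∑-cong (allFin n) (λ y →
                                               trans (cong (_* g y x) (⟦∈-minus⟧-swap V x y)) (*-assoc ⟦ lookup V x ⟧ _ _)))
                                           (∑-*ˡ ⟦ lookup V x ⟧ (allFin n) _)) ⟩
      ∑ (allFin n) (λ x → ⟦ lookup V x ⟧ * ∑ (allFin n) (λ y → ⟦ lookup (V - x) y ⟧ * g y x))
        ≡⟨ ∑-cong (allFin n) (λ x → cong (⟦ lookup V x ⟧ *_) (∑-split-at mm (V - x) u N K)) ⟩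
      ∑ (allFin n) (λ x → ⟦ lookup V x ⟧ * (⟦ lookup (V - x) u ⟧ * N + avoiding mm (V - x) u * K))
        ≡⟨ ∑-cong (allFin n) (λ x → distribute ⟦ lookup V x ⟧ ⟦ lookup (V - x) u ⟧ N (avoiding mm (V - x) u) K) ⟩
      ∑ (allFin n) (λ x → ⟦ lookup V x ⟧ * ⟦ lookup (V - x) u ⟧ * N + ⟦ lookup V x ⟧ * avoiding mm (V - x) u * K)
        ≡⟨ trans (∑-+ (allFin n) _ _) (cong₂ _+_ (∑-*ʳ N (allFin n) _) (∑-*ʳ K (allFin n) _)) ⟩
      ∑ (allFin n) (λ x → ⟦ lookup V x ⟧ * ⟦ lookup (V - x) u ⟧) * N + ∑ (allFin n) (λ x → ⟦ lookup V x ⟧ * avoiding mm (V - x) u) * K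
        ≡⟨ cong (λ m → m * N + _) (∑-minus-∋ V u t ∣V∣≡1+t u∈V) ⟩
      t * N + ∑ (allFin n) (λ x → ⟦ lookup V x ⟧ * avoiding mm (V - x) u) * K ∎
      where
      g : Fin n → Fin n → ℕ
      g y x = ⟦ y ≡ᵇ u ⟧ * N + ⟦ not (y ≡ᵇ u) ⟧ * (⟦ not (mm (V - x) y ≡ᵇ u) ⟧ * K)
      exchange : ∀ a b c → a * (b * c) ≡ b * (a * c)
      exchange = solve-∀
      distribute : ∀ w e N a K → w * (e * N + a * K) ≡ w * e * N + w * a * K
      distribute = solve-∀

    availCount-odd : 0 < t → odd (suc t) ≡ true → availCount (suc t) V u + K ≡ N + t * K
    availCount-odd 0<t odd-round = *-cancelˡ-≡ _ _ t {{>-nonZero 0<t}} (begin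
      t * (availCount (suc t) V u + K)
        ≡⟨ trans (*-distribˡ-+ t _ K) (cong (_+ t * K) (t*availCount-odd odd-round)) ⟩
      t * N + S * K + t * K
        ≡⟨ collect t N S K ⟩
      t * N + (S + t) * K
        ≡⟨ cong (λ m → t * N + m * K) (∑-avoiding-minus perfect V u t ∣V∣≡1+t (odd-suc⇒Even t odd-round) u∈V) ⟩
      t * N + t * t * K
        ≡⟨ factor t N K ⟩
      t * (N + t * K) ∎)
      where
      S : ℕ
      S = ∑ (allFin n) (λ x → ⟦ lookup V x ⟧ * avoiding mm (V - x) u)
      collect : ∀ t N S K → t * N + S * K + t * K ≡ t * N + (S + t) * K
      collect = solve-∀
      factor : ∀ t N K → t * N + t * t * K ≡ t * (N + t * K)
      factor = solve-∀

    availCount-step : 0 < t → availCount (suc t) V u + K ≡ N + t * K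
    availCount-step 0<t with odd (suc t) in parity
    ... | false = availCount-even parity
    ... | true  = availCount-odd 0<t parity

-- The invariant

-- The recurrence K' = N + (t - 1) K, N' = 2 K + t N (with t = 3 + m) preserves the invariant.
invariant-preserved : ∀ m D E K N → 3 * D * N + 2 * (K + N) * E ≡ 2 * (K + N) * D →
  3 * ((4 + m) * D) * (2 * K + (3 + m) * N) + 2 * ((N + (2 + m) * K) + (2 * K + (3 + m) * N)) * ((1 + m) * E)
    ≡ 2 * ((N + (2 + m) * K) + (2 * K + (3 + m) * N)) * ((4 + m) * D)
invariant-preserved m D E K N h = begin
  3 * ((4 + m) * D) * (2 * K + (3 + m) * N) + 2 * ((N + (2 + m) * K) + (2 * K + (3 + m) * N)) * ((1 + m) * E)
    ≡⟨ expand m D E K N ⟩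
  (4 + m) * (6 * D * (K + N) + (1 + m) * (3 * D * N + 2 * (K + N) * E))
    ≡⟨ cong (λ z → (4 + m) * (6 * D * (K + N) + (1 + m) * z)) h ⟩
  (4 + m) * (6 * D * (K + N) + (1 + m) * (2 * (K + N) * D))
    ≡⟨ collapse m D K N ⟩
  2 * ((N + (2 + m) * K) + (2 * K + (3 + m) * N)) * ((4 + m) * D) ∎
  where
  expand : ∀ m D E K N →
    3 * ((4 + m) * D) * (2 * K + (3 + m) * N) + 2 * ((N + (2 + m) * K) + (2 * K + (3 + m) * N)) * ((1 + m) * E)
      ≡ (4 + m) * (6 * D * (K + N) + (1 + m) * (3 * D * N + 2 * (K + N) * E))
  expand = solve-∀
  collapse : ∀ m D K N →
    (4 + m) * (6 * D * (K + N) + (1 + m) * (2 * (K + N) * D)) ≡ 2 * ((N + (2 + m) * K) + (2 * K + (3 + m) * N)) * ((4 + m) * D)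
  collapse = solve-∀

module Invariant {n : ℕ} {mm : Subset n → Fin n → Fin n} (perfect : PerfectOnEven mm) (k : ℕ) where

  open Counting mm k

  D E : ℕ → ℕ
  D t = t ! * (k ∸ 3) !
  E t = (t ∸ 3) ! * k !

  -- N / (K + N) = (2/3) (1 - E t / D t), multiplied out.
  Invariant : ℕ → Set
  Invariant t = Σ[ K ∈ ℕ ] Σ[ N ∈ ℕ ] Uniform t K N × (K + N ≡ t ! * length tapes)
                                      × (3 * D t * N + 2 * (K + N) * E t ≡ 2 * (K + N) * D t)

  invariant-k : Invariant k
  invariant-k = k ! * length tapes , 0 , uniform , +-identityʳ _ , balanced
    where
    nothing-matched : ∀ V u → matchedCount k V u ≡ 0
    nothing-matched V u = trans
      (∑-cong (arrangements k (allFin n)) (λ p → cong (⟦ sameSet (setOf p) V ⟧ *_)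
        (trans (∑-cong tapes (λ τ → trans (cong (λ A → ⟦ not (lookup A u) ⟧) (available-k mm k p τ))
                                           (cong (λ b → ⟦ not b ⟧) (lookup-replicate u true))))
               (∑-zero tapes))))
      (trans (∑-cong (arrangements k (allFin n)) (λ p → *-zeroʳ ⟦ sameSet (setOf p) V ⟧)) (∑-zero (arrangements k (allFin n))))
    uniform : Uniform k (k ! * length tapes) 0
    uniform V u ∣V∣≡k _ = trans (sym (+-identityʳ _)) (trans (cong (availCount k V u +_) (sym (nothing-matched V u)))
                            (availCount+matchedCount k V u ∣V∣≡k)) , nothing-matched V u
    balanced : 3 * D k * 0 + 2 * (k ! * length tapes + 0) * E k ≡ 2 * (k ! * length tapes + 0) * D k
    balanced rewrite *-zeroʳ (3 * D k) = cong (2 * (k ! * length tapes + 0) *_) (*-comm ((k ∸ 3) !) (k !))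

  invariant-suc : ∀ m → k ≤ 3 + m → 3 + m < n → Invariant (3 + m) → Invariant (4 + m)
  invariant-suc m k≤t t<n (K , N , uniform , total , balanced) = K' , N' , uniform' , total' , balanced'
    where
    t : ℕ
    t = 3 + m
    K' N' : ℕ
    K' = N + (2 + m) * K
    N' = 2 * K + (3 + m) * N
    split : (4 + m) * (K + N) ≡ K' + N'
    split = regroup m K N
      where
      regroup : ∀ m K N → (4 + m) * (K + N) ≡ (N + (2 + m) * K) + (2 * K + (3 + m) * N)
      regroup = solve-∀
    total' : K' + N' ≡ suc t ! * length tapes
    total' = trans (sym split) (trans (cong (suc t *_) total) (sym (*-assoc (suc t) (t !) (length tapes))))
    uniform' : Uniform (suc t) K' N'
    uniform' V u ∣V∣≡1+t u∈V = avail , +-cancelˡ-≡ K' _ _ (begin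
      K' + matchedCount (suc t) V u                       ≡⟨ cong (_+ matchedCount (suc t) V u) (sym avail) ⟩
      availCount (suc t) V u + matchedCount (suc t) V u   ≡⟨ availCount+matchedCount (suc t) V u ∣V∣≡1+t ⟩
      suc t ! * length tapes                              ≡⟨ sym total' ⟩
      K' + N'                                             ∎)
      where
      avail : availCount (suc t) V u ≡ K'
      avail = +-cancelʳ-≡ K _ _ (trans (Step.availCount-step perfect t k≤t t<n K N uniform V u ∣V∣≡1+t u∈V (s≤s z≤n))
                                       (peel m K N))
        where
        peel : ∀ m K N → N + (3 + m) * K ≡ N + (2 + m) * K + K
        peel = solve-∀
    balanced' : 3 * D (suc t) * N' + 2 * (K' + N') * E (suc t) ≡ 2 * (K' + N') * D (suc t)
    balanced' rewrite *-assoc (suc t) (t !) ((k ∸ 3) !) | *-assoc (suc m) (m !) (k !) =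
      invariant-preserved m (D t) (E t) K N balanced

  invariant : 3 ≤ k → ∀ t → k ≤ t → t ≤ n → Invariant t
  invariant 3≤k = ≤-induction (λ t → t ≤ n → Invariant t) k (λ _ → invariant-k) step
    where
    step : ∀ t → k ≤ t → (t ≤ n → Invariant t) → suc t ≤ n → Invariant (suc t)
    step (suc (suc (suc m))) k≤t ih t<n = invariant-suc m k≤t t<n (ih (<⇒≤ t<n))
    step 0                   k≤t _  _   = ⊥-elim (<⇒≱ (≤-trans 3≤k k≤t) z≤n)
    step 1                   k≤t _  _   = ⊥-elim (<⇒≱ (≤-trans 3≤k k≤t) (s≤s z≤n))
    step 2                   k≤t _  _   = ⊥-elim (<⇒≱ (≤-trans 3≤k k≤t) (s≤s (s≤s z≤n)))

-- The probability

-- The equation, moved to ℤ in the shape of the numerators that ℚᵘ arithmetic produces.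
⅔-equation-ℤ : ∀ x y E D → 3 * D * x + 2 * E * y ≡ 2 * D * y →
  (ℤ.+ x) ℤ.* (ℤ.+ (3 * (1 * D))) ≡ ((ℤ.+ 2) ℤ.* ((ℤ.+ 1) ℤ.* (ℤ.+ D) ℤ.+ (ℤ.- (ℤ.+ E)) ℤ.* (ℤ.+ 1))) ℤ.* (ℤ.+ y)
⅔-equation-ℤ x y E D h = begin
  (ℤ.+ x) ℤ.* (ℤ.+ (3 * (1 * D)))
    ≡⟨ cong ((ℤ.+ x) ℤ.*_) (trans (pos-* 3 (1 * D)) (cong ((ℤ.+ 3) ℤ.*_) (pos-* 1 D))) ⟩
  (ℤ.+ x) ℤ.* ((ℤ.+ 3) ℤ.* ((ℤ.+ 1) ℤ.* (ℤ.+ D)))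
    ≡⟨ isolate (ℤ.+ x) (ℤ.+ D) (ℤ.+ E) (ℤ.+ y) ⟩
  ((ℤ.+ 3) ℤ.* (ℤ.+ D) ℤ.* (ℤ.+ x) ℤ.+ (ℤ.+ 2) ℤ.* (ℤ.+ E) ℤ.* (ℤ.+ y)) ℤ.- (ℤ.+ 2) ℤ.* (ℤ.+ E) ℤ.* (ℤ.+ y)
    ≡⟨ cong (ℤ._- (ℤ.+ 2) ℤ.* (ℤ.+ E) ℤ.* (ℤ.+ y)) hℤ ⟩
  (ℤ.+ 2) ℤ.* (ℤ.+ D) ℤ.* (ℤ.+ y) ℤ.- (ℤ.+ 2) ℤ.* (ℤ.+ E) ℤ.* (ℤ.+ y)
    ≡⟨ factor (ℤ.+ D) (ℤ.+ E) (ℤ.+ y) ⟩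
  ((ℤ.+ 2) ℤ.* ((ℤ.+ 1) ℤ.* (ℤ.+ D) ℤ.+ (ℤ.- (ℤ.+ E)) ℤ.* (ℤ.+ 1))) ℤ.* (ℤ.+ y) ∎
  where
  isolate : ∀ X D E Y →
    X ℤ.* ((ℤ.+ 3) ℤ.* ((ℤ.+ 1) ℤ.* D)) ≡ ((ℤ.+ 3) ℤ.* D ℤ.* X ℤ.+ (ℤ.+ 2) ℤ.* E ℤ.* Y) ℤ.- (ℤ.+ 2) ℤ.* E ℤ.* Y
  isolate = ℤ-Solver.solve-∀
  factor : ∀ D E Y →
    (ℤ.+ 2) ℤ.* D ℤ.* Y ℤ.- (ℤ.+ 2) ℤ.* E ℤ.* Y ≡ ((ℤ.+ 2) ℤ.* ((ℤ.+ 1) ℤ.* D ℤ.+ (ℤ.- E) ℤ.* (ℤ.+ 1))) ℤ.* Y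
  factor = ℤ-Solver.solve-∀
  hℤ : (ℤ.+ 3) ℤ.* (ℤ.+ D) ℤ.* (ℤ.+ x) ℤ.+ (ℤ.+ 2) ℤ.* (ℤ.+ E) ℤ.* (ℤ.+ y) ≡ (ℤ.+ 2) ℤ.* (ℤ.+ D) ℤ.* (ℤ.+ y)
  hℤ = begin
    (ℤ.+ 3) ℤ.* (ℤ.+ D) ℤ.* (ℤ.+ x) ℤ.+ (ℤ.+ 2) ℤ.* (ℤ.+ E) ℤ.* (ℤ.+ y)
      ≡⟨ cong₂ ℤ._+_ (trans (cong (ℤ._* (ℤ.+ x)) (sym (pos-* 3 D))) (sym (pos-* (3 * D) x)))
                     (trans (cong (ℤ._* (ℤ.+ y)) (sym (pos-* 2 E))) (sym (pos-* (2 * E) y))) ⟩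
    (ℤ.+ (3 * D * x)) ℤ.+ (ℤ.+ (2 * E * y)) ≡⟨ sym (pos-+ (3 * D * x) (2 * E * y)) ⟩
    ℤ.+ (3 * D * x + 2 * E * y)             ≡⟨ cong ℤ.+_ h ⟩
    ℤ.+ (2 * D * y)                         ≡⟨ trans (pos-* (2 * D) y) (cong (ℤ._* (ℤ.+ y)) (pos-* 2 D)) ⟩
    (ℤ.+ 2) ℤ.* (ℤ.+ D) ℤ.* (ℤ.+ y)         ∎

ratio-⅔ : ∀ x y E D → 1 ≤ y → 1 ≤ D → 3 * D * x + 2 * E * y ≡ 2 * D * y →
          ratio x y ≡ ratio 2 3 *ℚ (1ℚ -ℚ ratio E D)
ratio-⅔ x (suc y) E (suc D) _ _ h = toℚᵘ-injective (ℚᵘ.≃-trans (toℚᵘ-fromℚᵘ (mkℚᵘ (ℤ.+ x) y))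
  (ℚᵘ.≃-trans (*≡* (⅔-equation-ℤ x (suc y) E (suc D) h)) (ℚᵘ.≃-sym unnormalised)))
  where
  unnormalised : toℚᵘ (ratio 2 3 *ℚ (1ℚ -ℚ ratio E (suc D)))
                 ≃ mkℚᵘ (ℤ.+ 2) 2 ℚᵘ.* (mkℚᵘ (ℤ.+ 1) 0 ℚᵘ.+ (ℚᵘ.- mkℚᵘ (ℤ.+ E) D))
  unnormalised = ℚᵘ.≃-trans (toℚᵘ-homo-* (ratio 2 3) (1ℚ -ℚ ratio E (suc D)))
    (ℚᵘ.*-congˡ {mkℚᵘ (ℤ.+ 2) 2} (ℚᵘ.≃-trans (toℚᵘ-homo-+ 1ℚ (-ℚ ratio E (suc D)))
      (ℚᵘ.+-congʳ (mkℚᵘ (ℤ.+ 1) 0)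
        (ℚᵘ.≃-trans (toℚᵘ-homo‿- (ratio E (suc D))) (ℚᵘ.-‿cong (toℚᵘ-fromℚᵘ (mkℚᵘ (ℤ.+ E) D)))))))

ratio-scaled-⅔ : ∀ f x y E D → 1 ≤ f → 1 ≤ y → 1 ≤ D → 3 * D * x + 2 * y * E ≡ 2 * y * D →
                 ratio (f * x) (f * y) ≡ ratio 2 3 *ℚ (1ℚ -ℚ ratio E D)
ratio-scaled-⅔ f x y E D 1≤f 1≤y 1≤D h = ratio-⅔ (f * x) (f * y) E D (*-mono-≤ 1≤f 1≤y) 1≤D (begin
  3 * D * (f * x) + 2 * E * (f * y) ≡⟨ pull f x y E D ⟩
  f * (3 * D * x + 2 * y * E)       ≡⟨ cong (f *_) h ⟩
  f * (2 * y * D)                   ≡⟨ push f y D ⟩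
  2 * D * (f * y)                   ∎)
  where
  pull : ∀ f x y E D → 3 * D * (f * x) + 2 * E * (f * y) ≡ f * (3 * D * x + 2 * y * E)
  pull = solve-∀
  push : ∀ f y D → f * (2 * y * D) ≡ 2 * D * (f * y)
  push = solve-∀

module _ {n : ℕ} (mm : Subset n → Fin n → Fin n) (k : ℕ) where

  open Counting mm k

  ∑-arrivalOrders-take : ∀ t → t ≤ n → (F : List (Fin n) → ℕ) →
    ∑ (arrivalOrders n) (λ σ → F (take t σ)) ≡ (n ∸ t) ! * ∑ (arrangements t (allFin n)) F
  ∑-arrivalOrders-take t t≤n F = trans (∑-perms-take (allFin n) t (subst (t ≤_) (sym length-allFin) t≤n) F)
                                       (cong (λ m → (m ∸ t) ! * ∑ (arrangements t (allFin n)) F) length-allFin)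
    where
    length-allFin : length (allFin n) ≡ n
    length-allFin = List.length-tabulate (λ i → i)

  count-conditioned : ∀ t → t ≤ n → (V : Subset n) → ∣ V ∣ ≡ t →
    count (λ ω → sameSet (setOf (take t (proj₁ ω))) V) (cartesianProduct (arrivalOrders n) tapes)
      ≡ (n ∸ t) ! * (t ! * length tapes)
  count-conditioned t t≤n V ∣V∣≡t = begin
    count (λ ω → sameSet (setOf (take t (proj₁ ω))) V) (cartesianProduct (arrivalOrders n) tapes)
      ≡⟨ trans (count≡∑ _ (cartesianProduct (arrivalOrders n) tapes)) (∑-cartesianProduct (arrivalOrders n) tapes _) ⟩
    ∑ (arrivalOrders n) (λ σ → ∑ tapes (λ _ → ⟦ sameSet (setOf (take t σ)) V ⟧))
      ≡⟨ ∑-arrivalOrders-take t t≤n (λ p → ∑ tapes (λ _ → ⟦ sameSet (setOf p) V ⟧)) ⟩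
    (n ∸ t) ! * ∑ (arrangements t (allFin n)) (λ p → ∑ tapes (λ _ → ⟦ sameSet (setOf p) V ⟧))
      ≡⟨ cong ((n ∸ t) ! *_) (begin
           ∑ (arrangements t (allFin n)) (λ p → ∑ tapes (λ _ → ⟦ sameSet (setOf p) V ⟧))
             ≡⟨ ∑-cong (arrangements t (allFin n)) (λ p → trans (∑-const tapes _) (*-comm (length tapes) _)) ⟩
           ∑ (arrangements t (allFin n)) (λ p → ⟦ sameSet (setOf p) V ⟧ * length tapes)
             ≡⟨ ∑-*ʳ (length tapes) (arrangements t (allFin n)) _ ⟩
           ∑ (arrangements t (allFin n)) (λ p → ⟦ sameSet (setOf p) V ⟧) * length tapes
             ≡⟨ cong (_* length tapes) (∑-arrangements-sameSet t V ∣V∣≡t) ⟩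
           t ! * length tapes ∎) ⟩
    (n ∸ t) ! * (t ! * length tapes) ∎

  count-matched : ∀ t → k ≤ t → t ≤ n → (V : Subset n) (u : Fin n) →
    count (λ ω → sameSet (setOf (take t (proj₁ ω))) V ∧ matchedBy mm k (proj₁ ω) (proj₂ ω) t u)
          (cartesianProduct (arrivalOrders n) tapes)
      ≡ (n ∸ t) ! * matchedCount t V u
  count-matched t k≤t t≤n V u = begin
    count (λ ω → sameSet (setOf (take t (proj₁ ω))) V ∧ matchedBy mm k (proj₁ ω) (proj₂ ω) t u)
          (cartesianProduct (arrivalOrders n) tapes)
      ≡⟨ trans (count≡∑ (λ ω → sameSet (setOf (take t (proj₁ ω))) V ∧ matchedBy mm k (proj₁ ω) (proj₂ ω) t u)
                        (cartesianProduct (arrivalOrders n) tapes))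
               (∑-cartesianProduct (arrivalOrders n) tapes _) ⟩
    ∑ (arrivalOrders n) (λ σ → ∑ tapes (λ τ → ⟦ sameSet (setOf (take t σ)) V ∧ not (lookup (availableAfter mm k σ τ t) u) ⟧))
      ≡⟨ ∑-cong (arrivalOrders n) (λ σ → trans (∑-cong tapes (λ τ → prefix-only σ τ))
                                               (∑-*ˡ ⟦ sameSet (setOf (take t σ)) V ⟧ tapes _)) ⟩
    ∑ (arrivalOrders n) (λ σ → ⟦ sameSet (setOf (take t σ)) V ⟧
                               * ∑ tapes (λ τ → ⟦ not (lookup (availableAfter mm k (take t σ) τ t) u) ⟧))
      ≡⟨ ∑-arrivalOrders-take t t≤n _ ⟩
    (n ∸ t) ! * matchedCount t V u ∎
    where
    prefix-only : ∀ σ τ → ⟦ sameSet (setOf (take t σ)) V ∧ not (lookup (availableAfter mm k σ τ t) u) ⟧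
                          ≡ ⟦ sameSet (setOf (take t σ)) V ⟧ * ⟦ not (lookup (availableAfter mm k (take t σ) τ t) u) ⟧
    prefix-only σ τ = trans (⟦∧⟧ (sameSet (setOf (take t σ)) V) (not (lookup (availableAfter mm k σ τ t) u)))
      (cong (λ A → ⟦ sameSet (setOf (take t σ)) V ⟧ * ⟦ not (lookup A u) ⟧)
            (available-prefix mm k t k≤t σ (take t σ) τ τ (sym (take-take≤ t t σ ≤-refl)) refl))

lemma2 : (n k : ℕ) → 3 ≤ k → k ≤ n →
         (G : WeightedGraph n) (mm : Subset n → Fin n → Fin n) → MaxMatchingOracle G mm →
         (t : ℕ) → k ≤ t → t ≤ n →
         (V : Subset n) → ∣ V ∣ ≡ t → (u : Fin n) → u ∈ V →
         probMatchedGiven mm k t V u ≡ targetProb k t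
lemma2 n k 3≤k k≤n G mm oracle t k≤t t≤n V ∣V∣≡t u u∈V
  with Invariant.invariant (maxMatching⇒PerfectOnEven mm G oracle) k 3≤k t k≤t t≤n
... | K , N , uniform , total , balanced = begin
  probMatchedGiven mm k t V u
    ≡⟨ cong₂ ratio (trans (count-matched mm k t k≤t t≤n V u) (cong (later *_) (proj₂ (uniform V u ∣V∣≡t ([]=⇒lookup u∈V)))))
                   (trans (count-conditioned mm k t t≤n V ∣V∣≡t) (cong (later *_) (sym total))) ⟩
  ratio (later * N) (later * (K + N))
    ≡⟨ ratio-scaled-⅔ later N (K + N) _ _ (1≤n! (n ∸ t)) some-pair (*-mono-≤ (1≤n! t) (1≤n! (k ∸ 3))) balanced ⟩
  targetProb k t ∎
  where
  later : ℕ
  later = (n ∸ t) !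
  some-pair : 1 ≤ K + N
  some-pair = subst (1 ≤_) (sym total) (*-mono-≤ (1≤n! t) (tapes-nonempty k 1 n (≤-trans (s≤s z≤n) 3≤k)))
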